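{- For all integers $n,g\geq 0$, $$\sum_{k=0}^{n}\binom{n}{k}\sum_{\substack{i+j=n+2-2g\\ i,j\geq 0}}c(n-k+1,i)\,(-1)^{k+1-j}\,c(k+1,j)=2^{n-2g}\,O(n+1,g).$$
   Context: $c(m,i)$ denotes the unsigned Stirling number of the first kind, i.e. the number of permutations of $[m]$ with exactly $i$ cycles. $O(m,g)$ denotes the number of permutations of $[m]=\{1,\dots,m\}$ consisting of exactly $m-2g$ cycles, all of which have odd length. -}

module Defs where

open import Data.Nat as ℕ using (ℕ; zero; suc; _+_; _*_; _∸_; _≤_; _%_)
open import Data.Nat.Properties using (_≤?_) renaming (_≟_ to _≟ℕ_)
open import Data.Nat.Combinatorics using (_C_)
open import Data.Fin using (Fin; toℕ)
open import Data.Fin.Properties using (all?; any?) renaming (_≟_ to _≟ᶠ_)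
open import Data.Vec using (Vec; lookup; []; _∷_)
open import Data.List as List using (List; []; _∷_; map; filter; length; concatMap; upTo; allFin; cartesianProduct)
open import Data.Integer as ℤ using (ℤ; +_; -1ℤ)
open import Data.Product using (_×_; _,_; ∃)
open import Relation.Binary.PropositionalEquality using (_≡_; _≢_)
open import Relation.Nullary using (Dec; ¬?)
open import Relation.Nullary.Decidable using (_×-dec_; _→-dec_)

vecs : (m k : ℕ) → List (Vec (Fin m) k)
vecs m zero = [] ∷ []
vecs m (suc k) = concatMap (λ a → map (a ∷_) (vecs m k)) (allFin m)

IsPerm : {m : ℕ} → (Fin m → Fin m) → Set
IsPerm {m} f = (∀ x y → f x ≡ f y → x ≡ y) × (∀ y → ∃ λ x → f x ≡ y)

isPerm? : {m : ℕ} → (f : Fin m → Fin m) → Dec (IsPerm f)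
isPerm? f = all? (λ x → all? (λ y → (f x ≟ᶠ f y) →-dec (x ≟ᶠ y)))
            ×-dec all? (λ y → any? (λ x → f x ≟ᶠ y))

-- the list of all permutations of [m] = Fin m, each listed exactly once (as its table)
permutations : (m : ℕ) → List (Vec (Fin m) m)
permutations m = filter (λ v → isPerm? (lookup v)) (vecs m m)

iter : {m : ℕ} → (Fin m → Fin m) → ℕ → Fin m → Fin m
iter f zero x = x
iter f (suc k) x = f (iter f k x)

-- x is the smallest element of its cycle (for a permutation of Fin m,
-- the cycle of x is {f^k x | k < m})
IsCycleMin : {m : ℕ} → (Fin m → Fin m) → Fin m → Set
IsCycleMin {m} f x = ∀ (k : Fin m) → toℕ x ≤ toℕ (iter f (toℕ k) x)

isCycleMin? : {m : ℕ} → (f : Fin m → Fin m) → (x : Fin m) → Dec (IsCycleMin f x)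
isCycleMin? f x = all? (λ k → toℕ x ≤? toℕ (iter f (toℕ k) x))

-- number of cycles of f = number of cycle minima
numCycles : {m : ℕ} → (Fin m → Fin m) → ℕ
numCycles {m} f = length (filter (isCycleMin? f) (allFin m))

IsCycleLength : {m : ℕ} → (Fin m → Fin m) → Fin m → ℕ → Set
IsCycleLength f x k = (1 ≤ k) × (iter f k x ≡ x) × (∀ (j : Fin k) → 1 ≤ toℕ j → iter f (toℕ j) x ≢ x)

isCycleLength? : {m : ℕ} → (f : Fin m → Fin m) → (x : Fin m) → (k : ℕ) → Dec (IsCycleLength f x k)
isCycleLength? f x k = (1 ≤? k) ×-dec ((iter f k x ≟ᶠ x)
  ×-dec all? (λ j → (1 ≤? toℕ j) →-dec ¬? (iter f (toℕ j) x ≟ᶠ x)))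

-- all cycles of f have odd length (cycle lengths of a permutation of Fin m are ≤ m)
AllCyclesOdd : {m : ℕ} → (Fin m → Fin m) → Set
AllCyclesOdd {m} f = ∀ (x : Fin m) (k : Fin (suc m)) → IsCycleLength f x (toℕ k) → toℕ k % 2 ≡ 1

allCyclesOdd? : {m : ℕ} → (f : Fin m → Fin m) → Dec (AllCyclesOdd f)
allCyclesOdd? f = all? (λ x → all? (λ k → isCycleLength? f x (toℕ k) →-dec (toℕ k % 2 ≟ℕ 1)))

-- c(m,i): unsigned Stirling number of the first kind =
-- number of permutations of [m] with exactly i cycles
c : ℕ → ℕ → ℕ
c m i = length (filter (λ v → numCycles (lookup v) ≟ℕ i) (permutations m))

-- O(m,g): number of permutations of [m] with exactly m - 2g cycles, all of odd length.
-- (stated as  #cycles + 2g = m  so that no truncated subtraction occurs; if 2g > m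
-- there are no such permutations)
O : ℕ → ℕ → ℕ
O m g = length (filter (λ v → (numCycles (lookup v) + 2 * g ≟ℕ m) ×-dec allCyclesOdd? (lookup v))
                       (permutations m))

sumℤ : List ℤ → ℤ
sumℤ = List.foldr ℤ._+_ (+ 0)

sign : ℕ → ℤ
sign e = -1ℤ ℤ.^ e

-- inner sum over i + j = n + 2 - 2g, i, j ≥ 0 (all such pairs have i, j ≤ n + 2);
-- (-1)^(k+1-j) = (-1)^(k+1+j)
innerSum : ℕ → ℕ → ℕ → ℤ
innerSum n g k = sumℤ (map (λ { (i , j) → (+ c (n ∸ k + 1) i) ℤ.* sign (k + 1 + j) ℤ.* (+ c (k + 1) j) })
  (filter (λ { (i , j) → i + j + 2 * g ≟ℕ n + 2 }) (cartesianProduct (upTo (n + 3)) (upTo (n + 3)))))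

LHS : ℕ → ℕ → ℤ
LHS n g = sumℤ (map (λ k → (+ (n C k)) ℤ.* innerSum n g k) (upTo (suc n)))

-- Put T(a,b,d) = Σ_{i+j=d} c(a+1,i) (-1)^(b+1+j) c(b+1,j) and
-- F(n,d) = Σ_k C(n,k) T(n-k,k,d), so that the left-hand side is F(n,n+2-2g).
-- The Stirling recurrence c(m+1,i+1) = c(m,i) + m c(m,i+1) gives shift
-- recurrences for T in a and in b; combined with Pascal's rule and the
-- absorption identity k C(n,k) = n C(n-1,k-1) they yield
--   F(n+2,d) = 2 F(n+1,d-1) + (n+1)(n+2) F(n,d).
-- The numbers A(m,k) of permutations of [m] with k cycles, all odd, satisfy
--   A(m+2,k+1) = A(m+1,k) + (m+1) m A(m,k+1)
-- (the point 0 is either a fixed point, or it is inserted into a cycle of a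
-- permutation of m points together with one further new point), and the same
-- recurrence shows F(n,e+2) = 2^e A(n+1,e+1), F(n,0) = F(n,1) = 0.
-- Since O(n+1,g) = A(n+1,n+1-2g), the theorem follows.
module Submission where

-- Binomial coefficients through Pascal's rule, which is the form used in the
-- binomial sums below; `bin≡C` relates them to the library's `_C_`.
module Binomial where
  open import Data.Nat
  open import Data.Nat.Properties
  open import Data.Nat.Combinatorics using (_C_; nCk+nC[k+1]≡[n+1]C[k+1])
  open import Data.Nat.Combinatorics.Specification using (k>n⇒nCk≡0)
  open import Relation.Binary.PropositionalEquality
  open import Data.Nat.Tactic.RingSolver

  bin : ℕ → ℕ → ℕ
  bin n zero = 1
  bin zero (suc k) = 0
  bin (suc n) (suc k) = bin n k + bin n (suc k)

  bin≡C : ∀ n k → bin n k ≡ n C k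
  bin≡C n zero = refl
  bin≡C zero (suc k) = sym (k>n⇒nCk≡0 {0} {suc k} (s≤s z≤n))
  bin≡C (suc n) (suc k) = trans (cong₂ _+_ (bin≡C n k) (bin≡C n (suc k))) (nCk+nC[k+1]≡[n+1]C[k+1] n k)

  bin-big : ∀ n k → n < k → bin n k ≡ 0
  bin-big zero (suc k) _ = refl
  bin-big (suc n) (suc k) (s≤s lt) = cong₂ _+_ (bin-big n k lt) (bin-big n (suc k) (m<n⇒m<1+n lt))

  bin-1 : ∀ n → bin n 1 ≡ n
  bin-1 zero = refl
  bin-1 (suc n) = cong suc (bin-1 n)

  absorb : ∀ n k → suc k * bin (suc n) (suc k) ≡ suc n * bin n k
  absorb zero zero = refl
  absorb zero (suc k) = *-zeroʳ (suc (suc k))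
  absorb (suc n) zero = trans (*-identityˡ _) (trans (bin-1 (suc (suc n))) (sym (*-identityʳ _)))
  absorb (suc n) (suc k) = begin
      suc (suc k) * (bin (suc n) (suc k) + bin (suc n) (suc (suc k)))
    ≡⟨ distrib k (bin (suc n) (suc k)) (bin (suc n) (suc (suc k))) ⟩
      (suc k * bin (suc n) (suc k) + bin (suc n) (suc k)) + suc (suc k) * bin (suc n) (suc (suc k))
    ≡⟨ cong₂ (λ a b → (a + bin (suc n) (suc k)) + b) (absorb n k) (absorb n (suc k)) ⟩
      (suc n * bin n k + (bin n k + bin n (suc k))) + suc n * bin n (suc k)
    ≡⟨ collect n (bin n k) (bin n (suc k)) ⟩
      suc (suc n) * (bin n k + bin n (suc k))
    ∎ where
      open ≡-Reasoning
      distrib : ∀ k x y → suc (suc k) * (x + y) ≡ (suc k * x + x) + suc (suc k) * y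
      distrib = solve-∀
      collect : ∀ n x y → (suc n * x + (x + y)) + suc n * y ≡ suc (suc n) * (x + y)
      collect = solve-∀

module FiniteSums where
  open import Data.Nat using (ℕ; zero; suc; _∸_; _≤_; _<_; z≤n; s≤s)
  import Data.Nat.Properties as ℕP
  open import Data.Integer using (ℤ; +_; _+_; _*_)
  open import Data.Integer.Properties
  open import Relation.Binary.PropositionalEquality
  open import Data.Integer.Tactic.RingSolver
  open Binomial

  Σ : ℕ → (ℕ → ℤ) → ℤ
  Σ zero f = + 0
  Σ (suc n) f = f 0 + Σ n (λ i → f (suc i))

  Σ-cong : ∀ n {f g : ℕ → ℤ} → (∀ i → i < n → f i ≡ g i) → Σ n f ≡ Σ n g
  Σ-cong zero h = refl
  Σ-cong (suc n) h = cong₂ _+_ (h 0 (s≤s z≤n)) (Σ-cong n (λ i lt → h (suc i) (s≤s lt)))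

  Σ-+ : ∀ n f g → Σ n (λ i → f i + g i) ≡ Σ n f + Σ n g
  Σ-+ zero f g = refl
  Σ-+ (suc n) f g = trans (cong (_+_ (f 0 + g 0)) (Σ-+ n (λ i → f (suc i)) (λ i → g (suc i)))) (interchange (f 0) (g 0) (Σ n (λ i → f (suc i))) (Σ n (λ i → g (suc i))))
    where interchange : ∀ a b x y → a + b + (x + y) ≡ a + x + (b + y)
          interchange = solve-∀

  Σ-* : ∀ n a f → Σ n (λ i → a * f i) ≡ a * Σ n f
  Σ-* zero a f = sym (*-zeroʳ a)
  Σ-* (suc n) a f = trans (cong (_+_ (a * f 0)) (Σ-* n a (λ i → f (suc i)))) (sym (*-distribˡ-+ a (f 0) (Σ n (λ i → f (suc i)))))

  Σ-0 : ∀ n f → (∀ i → i < n → f i ≡ + 0) → Σ n f ≡ + 0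
  Σ-0 zero f h = refl
  Σ-0 (suc n) f h = cong₂ _+_ (h 0 (s≤s z≤n)) (Σ-0 n (λ i → f (suc i)) (λ i lt → h (suc i) (s≤s lt)))

  Σ-last : ∀ n f → Σ (suc n) f ≡ Σ n f + f n
  Σ-last zero f = trans (+-identityʳ (f 0)) (sym (+-identityˡ (f 0)))
  Σ-last (suc n) f = trans (cong (_+_ (f 0)) (Σ-last n (λ i → f (suc i)))) (sym (+-assoc (f 0) (Σ n (λ i → f (suc i))) (f (suc n))))

  -- multiplication of a generating sequence by the formal variable: (sh P) d = P (d-1)
  sh : (ℕ → ℤ) → ℕ → ℤ
  sh P zero = + 0
  sh P (suc d) = P d

  conv : (ℕ → ℤ) → (ℕ → ℤ) → ℕ → ℤ
  conv P Q d = Σ (suc d) (λ i → P i * Q (d ∸ i))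

  conv-shˡ : ∀ P Q d → conv (sh P) Q d ≡ sh (conv P Q) d
  conv-shˡ P Q zero = trans (+-identityʳ _) (*-zeroˡ (Q 0))
  conv-shˡ P Q (suc d) = trans (cong (_+ conv P Q d) (*-zeroˡ (Q (suc d)))) (+-identityˡ _)

  conv-shʳ : ∀ P Q d → conv P (sh Q) d ≡ sh (conv P Q) d
  conv-shʳ P Q zero = trans (+-identityʳ _) (*-zeroʳ (P 0))
  conv-shʳ P Q (suc d) = begin
      Σ (suc (suc d)) (λ i → P i * sh Q (suc d ∸ i))
    ≡⟨ Σ-last (suc d) (λ i → P i * sh Q (suc d ∸ i)) ⟩
      Σ (suc d) (λ i → P i * sh Q (suc d ∸ i)) + P (suc d) * sh Q (d ∸ d)
    ≡⟨ cong₂ _+_ (Σ-cong (suc d) (λ i lt → cong (λ z → P i * sh Q z) (ℕP.+-∸-assoc 1 (ℕP.≤-pred lt))))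
                 (trans (cong (λ z → P (suc d) * sh Q z) (ℕP.n∸n≡0 d)) (*-zeroʳ (P (suc d)))) ⟩
      Σ (suc d) (λ i → P i * Q (d ∸ i)) + + 0
    ≡⟨ +-identityʳ _ ⟩
      conv P Q d
    ∎ where open ≡-Reasoning

  conv-congˡ : ∀ {P P'} Q d → (∀ i → P i ≡ P' i) → conv P Q d ≡ conv P' Q d
  conv-congˡ Q d h = Σ-cong (suc d) (λ i _ → cong (_* Q (d ∸ i)) (h i))

  conv-congʳ : ∀ P {Q Q'} d → (∀ i → Q i ≡ Q' i) → conv P Q d ≡ conv P Q' d
  conv-congʳ P d h = Σ-cong (suc d) (λ i _ → cong (P i *_) (h (d ∸ i)))

  conv-+ˡ : ∀ P P' Q d → conv (λ i → P i + P' i) Q d ≡ conv P Q d + conv P' Q d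
  conv-+ˡ P P' Q d = trans (Σ-cong (suc d) (λ i _ → *-distribʳ-+ (Q (d ∸ i)) (P i) (P' i))) (Σ-+ (suc d) (λ i → P i * Q (d ∸ i)) (λ i → P' i * Q (d ∸ i)))

  conv-+ʳ : ∀ P Q Q' d → conv P (λ i → Q i + Q' i) d ≡ conv P Q d + conv P Q' d
  conv-+ʳ P Q Q' d = trans (Σ-cong (suc d) (λ i _ → *-distribˡ-+ (P i) (Q (d ∸ i)) (Q' (d ∸ i)))) (Σ-+ (suc d) (λ i → P i * Q (d ∸ i)) (λ i → P i * Q' (d ∸ i)))

  conv-*ˡ : ∀ a P Q d → conv (λ i → a * P i) Q d ≡ a * conv P Q d
  conv-*ˡ a P Q d = trans (Σ-cong (suc d) (λ i _ → *-assoc a (P i) (Q (d ∸ i)))) (Σ-* (suc d) a (λ i → P i * Q (d ∸ i)))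

  conv-*ʳ : ∀ a P Q d → conv P (λ i → a * Q i) d ≡ a * conv P Q d
  conv-*ʳ a P Q d = trans (Σ-cong (suc d) (λ i _ → leftComm a (P i) (Q (d ∸ i)))) (Σ-* (suc d) a (λ i → P i * Q (d ∸ i)))
    where leftComm : ∀ a x y → x * (a * y) ≡ a * (x * y)
          leftComm = solve-∀

  B : ℕ → (ℕ → ℕ → ℤ) → ℤ
  B n h = Σ (suc n) (λ k → + bin n k * h (n ∸ k) k)

  B-cong : ∀ n {h h' : ℕ → ℕ → ℤ} → (∀ k → k ≤ n → h (n ∸ k) k ≡ h' (n ∸ k) k) → B n h ≡ B n h'
  B-cong n eq = Σ-cong (suc n) (λ k lt → cong (+ bin n k *_) (eq k (ℕP.≤-pred lt)))

  B-+ : ∀ n (h h' : ℕ → ℕ → ℤ) → B n (λ a b → h a b + h' a b) ≡ B n h + B n h'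
  B-+ n h h' = trans (Σ-cong (suc n) (λ k _ → *-distribˡ-+ (+ bin n k) (h (n ∸ k) k) (h' (n ∸ k) k))) (Σ-+ (suc n) (λ k → + bin n k * h (n ∸ k) k) (λ k → + bin n k * h' (n ∸ k) k))

  B-* : ∀ n x (h : ℕ → ℕ → ℤ) → B n (λ a b → x * h a b) ≡ x * B n h
  B-* n x h = trans (Σ-cong (suc n) (λ k _ → leftComm x (+ bin n k) (h (n ∸ k) k))) (Σ-* (suc n) x (λ k → + bin n k * h (n ∸ k) k))
    where leftComm : ∀ a x y → x * (a * y) ≡ a * (x * y)
          leftComm = solve-∀

  ∸-suc-lt : ∀ n k → k < n → n ∸ k ≡ suc (n ∸ suc k)
  ∸-suc-lt (suc n) zero _ = refl
  ∸-suc-lt (suc n) (suc k) (s≤s lt) = ∸-suc-lt n k lt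

  B-pascal : ∀ n (h : ℕ → ℕ → ℤ) → B (suc n) h ≡ B n (λ a b → h (suc a) b + h a (suc b))
  B-pascal n h = begin
      + 1 * h (suc n) 0 + Σ (suc n) (λ k → + bin (suc n) (suc k) * h (n ∸ k) (suc k))
    ≡⟨ cong (_+_ (+ 1 * h (suc n) 0)) (trans (Σ-cong (suc n) (λ k _ → trans (cong (_* h (n ∸ k) (suc k)) (pos-+ (bin n k) (bin n (suc k)))) (*-distribʳ-+ (h (n ∸ k) (suc k)) (+ bin n k) (+ bin n (suc k))))) (Σ-+ (suc n) (λ k → + bin n k * h (n ∸ k) (suc k)) (λ k → + bin n (suc k) * h (n ∸ k) (suc k)))) ⟩
      + 1 * h (suc n) 0 + (X + Y)
    ≡⟨ regroup (+ 1 * h (suc n) 0) X Y ⟩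
      (+ 1 * h (suc n) 0 + Y) + X
    ≡⟨ cong (_+ X) (cong (_+_ (+ 1 * h (suc n) 0)) Yeq) ⟩
      Σ (suc n) (λ k → + bin n k * h (suc (n ∸ k)) k) + X
    ≡⟨ sym (Σ-+ (suc n) (λ k → + bin n k * h (suc (n ∸ k)) k) (λ k → + bin n k * h (n ∸ k) (suc k))) ⟩
      Σ (suc n) (λ k → + bin n k * h (suc (n ∸ k)) k + + bin n k * h (n ∸ k) (suc k))
    ≡⟨ Σ-cong (suc n) (λ k _ → sym (*-distribˡ-+ (+ bin n k) (h (suc (n ∸ k)) k) (h (n ∸ k) (suc k)))) ⟩
      B n (λ a b → h (suc a) b + h a (suc b))
    ∎ where
      open ≡-Reasoning
      X : ℤ
      X = Σ (suc n) (λ k → + bin n k * h (n ∸ k) (suc k))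
      Y : ℤ
      Y = Σ (suc n) (λ k → + bin n (suc k) * h (n ∸ k) (suc k))
      regroup : ∀ a x y → a + (x + y) ≡ (a + y) + x
      regroup = solve-∀
      -- Y is the k ≥ 1 part of B n (h(a+1,b)); its top term C(n,n+1) vanishes
      Yeq : Y ≡ Σ n (λ k → + bin n (suc k) * h (suc (n ∸ suc k)) (suc k))
      Yeq = trans (Σ-last n (λ k → + bin n (suc k) * h (n ∸ k) (suc k))) (trans (cong₂ _+_
              (Σ-cong n (λ k lt → cong (λ z → + bin n (suc k) * h z (suc k)) (∸-suc-lt n k lt)))
              (trans (cong (λ z → + z * h (n ∸ n) (suc n)) (bin-big n (suc n) (ℕP.n<1+n n))) (*-zeroˡ (h (n ∸ n) (suc n)))))
              (+-identityʳ (Σ n (λ k → + bin n (suc k) * h (suc (n ∸ suc k)) (suc k)))))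

  B-absorb : ∀ n (h : ℕ → ℕ → ℤ) → B (suc n) (λ a b → + b * h a b) ≡ + suc n * B n (λ a b → h a (suc b))
  B-absorb n h = begin
      + 1 * (+ 0 * h (suc n) 0) + Σ (suc n) (λ k → + bin (suc n) (suc k) * (+ suc k * h (n ∸ k) (suc k)))
    ≡⟨ trans (cong (_+ Σ (suc n) (λ k → + bin (suc n) (suc k) * (+ suc k * h (n ∸ k) (suc k)))) (trans (*-identityˡ (+ 0 * h (suc n) 0)) (*-zeroˡ (h (suc n) 0)))) (+-identityˡ (Σ (suc n) (λ k → + bin (suc n) (suc k) * (+ suc k * h (n ∸ k) (suc k))))) ⟩
      Σ (suc n) (λ k → + bin (suc n) (suc k) * (+ suc k * h (n ∸ k) (suc k)))
    ≡⟨ Σ-cong (suc n) {λ k → + bin (suc n) (suc k) * (+ suc k * h (n ∸ k) (suc k))} {λ k → + suc n * (+ bin n k * h (n ∸ k) (suc k))} (λ k _ → step k) ⟩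
      Σ (suc n) (λ k → + suc n * (+ bin n k * h (n ∸ k) (suc k)))
    ≡⟨ Σ-* (suc n) (+ suc n) (λ k → + bin n k * h (n ∸ k) (suc k)) ⟩
      + suc n * B n (λ a b → h a (suc b))
    ∎ where
      open ≡-Reasoning
      swap : ∀ a b x → a * (b * x) ≡ (b * a) * x
      swap = solve-∀
      step : ∀ k → + bin (suc n) (suc k) * (+ suc k * h (n ∸ k) (suc k)) ≡ + suc n * (+ bin n k * h (n ∸ k) (suc k))
      step k = trans (swap (+ bin (suc n) (suc k)) (+ suc k) (h (n ∸ k) (suc k)))
               (trans (cong (_* h (n ∸ k) (suc k)) (trans (sym (pos-* (suc k) (bin (suc n) (suc k)))) (trans (cong +_ (absorb n k)) (pos-* (suc n) (bin n k)))))
               (*-assoc (+ suc n) (+ bin n k) (h (n ∸ k) (suc k))))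

module Counting where
  open import Data.Nat using (ℕ; zero; suc; _+_; _*_)
  import Data.Nat.Properties as ℕP
  open import Algebra.Properties.CommutativeSemigroup ℕP.+-commutativeSemigroup using (x∙yz≈y∙xz)
  open import Data.Fin as F using (Fin; punchIn)
  open import Data.Fin.Properties using (_≟_)
  open import Data.List using (List; []; _∷_; length; filter; map; cartesianProduct; allFin; tabulate)
  open import Data.List.Properties using (length-map; length-++; filter-≐; filter-++; filter-all; filter-none; map-tabulate)
  open import Data.List.Membership.Propositional using (_∈_)
  open import Data.List.Membership.Propositional.Properties using (∈-filter⁺; ∈-filter⁻; ∈-map⁺; ∈-map⁻; ∈-allFin)
  open import Data.List.Membership.Propositional.Properties.WithK using (unique∧set⇒bag)
  open import Data.List.Relation.Binary.BagAndSetEquality using (∼bag⇒↭)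
  open import Data.List.Relation.Binary.Permutation.Propositional.Properties using (↭-length)
  open import Data.List.Relation.Unary.Any using (here)
  open import Data.List.Relation.Unary.All as All using (All; []; _∷_)
  open import Data.List.Relation.Unary.All.Properties using (all-filter)
  open import Data.List.Relation.Unary.AllPairs using ([]; _∷_)
  open import Data.List.Relation.Unary.Unique.Propositional using (Unique)
  import Data.List.Relation.Unary.Unique.Propositional.Properties as UP
  open import Data.List.Relation.Unary.Unique.Propositional.Properties using (allFin⁺)
  open import Data.Product using (_×_; _,_; proj₂; ∃)
  open import Data.Unit using (⊤; tt)
  open import Function using (_∘_; id)
  open import Function.Bundles using (mk⇔)
  open import Relation.Binary.PropositionalEquality
  open import Relation.Unary using (Decidable)
  open import Relation.Nullary using (Dec; yes; no; ¬_)
  open import Relation.Nullary.Decidable using (_×-dec_; ¬?)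
  open import Data.Empty using (⊥-elim)

  count : {A : Set} {P : A → Set} → Decidable P → List A → ℕ
  count P? L = length (filter P? L)

  module _ {A : Set} {P Q : A → Set} (P? : Decidable P) (Q? : Decidable Q) where
    count-ext : (∀ a → P a → Q a) → (∀ a → Q a → P a) → ∀ L → count P? L ≡ count Q? L
    count-ext pq qp L = cong length (filter-≐ P? Q? ((λ {a} → pq a) , (λ {a} → qp a)) L)

    count-split : ∀ L → count P? L ≡ count (λ a → P? a ×-dec Q? a) L + count (λ a → P? a ×-dec ¬? (Q? a)) L
    count-split [] = refl
    count-split (x ∷ xs) with P? x | Q? x
    ... | yes p | yes q = cong suc (count-split xs)
    ... | yes p | no ¬q = trans (cong suc (count-split xs)) (sym (ℕP.+-suc _ _))
    ... | no ¬p | yes q = count-split xs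
    ... | no ¬p | no ¬q = count-split xs

    count-ff : ∀ L → length (filter Q? (filter P? L)) ≡ count (λ a → P? a ×-dec Q? a) L
    count-ff [] = refl
    count-ff (x ∷ xs) with P? x
    ... | no ¬p = count-ff xs
    ... | yes p with Q? x
    ...   | yes q = cong suc (count-ff xs)
    ...   | no ¬q = count-ff xs

  module _ {A : Set} {P : A → Set} (P? : Decidable P) where
    count-all : (∀ a → P a) → ∀ L → count P? L ≡ length L
    count-all h L = cong length (filter-all P? (All.universal h L))

    count-none : (∀ a → ¬ P a) → ∀ L → count P? L ≡ 0
    count-none h L = cong length (filter-none P? (All.universal h L))

  count-map : ∀ {A B : Set} {P : B → Set} (P? : Decidable P) (f : A → B) xs → count P? (map f xs) ≡ count (P? ∘ f) xs
  count-map P? f [] = refl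
  count-map P? f (x ∷ xs) with P? (f x)
  ... | yes _ = cong suc (count-map P? f xs)
  ... | no _ = count-map P? f xs

  sumL : {A : Set} → (A → ℕ) → List A → ℕ
  sumL f [] = 0
  sumL f (x ∷ xs) = f x + sumL f xs

  count-cart : ∀ {A B : Set} {R : A × B → Set} (R? : Decidable R) xs ys →
    count R? (cartesianProduct xs ys) ≡ sumL (λ x → count (λ y → R? (x , y)) ys) xs
  count-cart R? [] ys = refl
  count-cart R? (x ∷ xs) ys = trans (cong length (filter-++ R? (map (x ,_) ys) _))
    (trans (length-++ (filter R? (map (x ,_) ys))) (cong₂ _+_ (count-map R? (x ,_) ys) (count-cart R? xs ys)))

  sumL-const : ∀ {A : Set} (f : A → ℕ) c → (∀ a → f a ≡ c) → ∀ xs → sumL f xs ≡ length xs * c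
  sumL-const f c h [] = refl
  sumL-const f c h (x ∷ xs) = cong₂ _+_ (h x) (sumL-const f c h xs)

  -- The two
  -- filtered lists are duplicate-free and have the same elements, hence they are
  -- permutations of each other.
  module _ {A B : Set} {P : A → Set} (P? : Decidable P) {Q : B → Set} (Q? : Decidable Q)
    (LA : List A) (LB : List B) (uA : Unique LA) (uB : Unique LB)
    (cA : ∀ a → a ∈ LA) (cB : ∀ b → b ∈ LB)
    (φ : B → A) (pres : ∀ {b} → Q b → P (φ b)) (inj : ∀ {b b'} → Q b → Q b' → φ b ≡ φ b' → b ≡ b')
    (surj : ∀ {a} → P a → ∃ λ b → Q b × φ b ≡ a) where

    private
      unique-image : ∀ xs → All Q xs → Unique xs → Unique (map φ xs)
      unique-image [] _ _ = []
      unique-image (x ∷ xs) (qx ∷ qs) (ax ∷ u) = distinct xs qs ax ∷ unique-image xs qs u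
        where
          distinct : ∀ ys → All Q ys → All (x ≢_) ys → All (φ x ≢_) (map φ ys)
          distinct [] _ _ = []
          distinct (y ∷ ys) (qy ∷ qys) (ne ∷ nes) = (λ eq → ne (inj qx qy eq)) ∷ distinct ys qys nes

      to : ∀ {z} → z ∈ filter P? LA → z ∈ map φ (filter Q? LB)
      to m with surj (proj₂ (∈-filter⁻ P? {xs = LA} m))
      ... | b , qb , refl = ∈-map⁺ φ (∈-filter⁺ Q? (cB b) qb)

      from : ∀ {z} → z ∈ map φ (filter Q? LB) → z ∈ filter P? LA
      from m with ∈-map⁻ φ m
      ... | b , mb , refl = ∈-filter⁺ P? (cA (φ b)) (pres (proj₂ (∈-filter⁻ Q? {xs = LB} mb)))

    transfer : count P? LA ≡ count Q? LB
    transfer = trans (↭-length (∼bag⇒↭ (unique∧set⇒bag (UP.filter⁺ P? uA)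
                       (unique-image _ (all-filter Q? LB) (UP.filter⁺ Q? uB)) (mk⇔ to from))))
                     (length-map φ (filter Q? LB))

  ind : ∀ {X : Set} → Dec X → ℕ
  ind (yes _) = 1
  ind (no _) = 0

  ind-yes : ∀ {X : Set} (d : Dec X) → X → ind d ≡ 1
  ind-yes (yes _) _ = refl
  ind-yes (no n) x = ⊥-elim (n x)

  ind-no : ∀ {X : Set} (d : Dec X) → ¬ X → ind d ≡ 0
  ind-no (yes x) n = ⊥-elim (n x)
  ind-no (no _) _ = refl

  ind-ext : ∀ {X Y : Set} (d : Dec X) (e : Dec Y) → (X → Y) → (Y → X) → ind d ≡ ind e
  ind-ext (yes x) (yes y) _ _ = refl
  ind-ext (yes x) (no ny) xy _ = ⊥-elim (ny (xy x))
  ind-ext (no nx) (yes y) _ yx = ⊥-elim (nx (yx y))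
  ind-ext (no _) (no _) _ _ = refl

  count-cons : ∀ {A : Set} {P : A → Set} (P? : Decidable P) x xs → count P? (x ∷ xs) ≡ ind (P? x) + count P? xs
  count-cons P? x xs with P? x
  ... | yes _ = refl
  ... | no _ = refl

  count-suc : ∀ {n} {P : Fin (suc n) → Set} (P? : Decidable P) → count P? (allFin (suc n)) ≡ ind (P? F.zero) + count (λ x → P? (F.suc x)) (allFin n)
  count-suc {n} P? = trans (count-cons P? F.zero (tabulate F.suc))
    (cong (ind (P? F.zero) +_) (trans (cong (count P?) (sym (map-tabulate id F.suc))) (count-map P? F.suc (allFin n))))

  count-punch : ∀ {n} (p : Fin (suc n)) {P : Fin (suc n) → Set} (P? : Decidable P) →
    count P? (allFin (suc n)) ≡ ind (P? p) + count (λ x → P? (punchIn p x)) (allFin n)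
  count-punch F.zero P? = count-suc P?
  count-punch {suc n} (F.suc p) P? = trans (count-suc P?)
    (trans (cong (ind (P? F.zero) +_) (count-punch p (λ x → P? (F.suc x))))
    (trans (x∙yz≈y∙xz (ind (P? F.zero)) (ind (P? (F.suc p))) _)
    (cong (ind (P? (F.suc p)) +_) (sym (count-suc (λ x → P? (punchIn (F.suc p) x)))))))

  count-single : ∀ {n} (x0 : Fin n) → count (λ x → x ≟ x0) (allFin n) ≡ 1
  count-single {n} x0 = transfer (λ x → x ≟ x0) (λ (_ : ⊤) → yes tt) (allFin n) (tt ∷ []) (allFin⁺ n) ([] ∷ [])
    ∈-allFin (λ { tt → here refl }) (λ _ → x0) (λ _ → refl) (λ { {tt} {tt} _ _ _ → refl }) (λ { refl → tt , tt , refl })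

module Orbits where
  open import Data.Nat using (ℕ; zero; suc; _+_; _*_; _∸_; _≤_; _<_; s≤s; _%_; _/_)
  import Data.Nat.Properties as ℕP
  open import Data.Nat.DivMod using (m≡m%n+[m/n]*n; m%n<n)
  open import Data.Fin using (Fin; toℕ; fromℕ<)
  import Data.Fin.Properties as FP
  open import Data.Product using (_×_; _,_; proj₁; proj₂; ∃)
  open import Data.Unit using (⊤; tt)
  open import Data.List using (allFin)
  open import Data.List.Properties using (length-tabulate)
  open import Data.List.Membership.Propositional.Properties using (∈-allFin)
  open import Data.List.Relation.Unary.Unique.Propositional.Properties using (allFin⁺)
  open import Relation.Binary.PropositionalEquality
  open import Relation.Nullary
  open import Relation.Nullary.Decidable using (_×-dec_)
  open import Data.Empty
  open import Relation.Binary.Definitions using (tri<; tri≈; tri>)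
  open import Defs using (iter; IsCycleLength; IsCycleMin; AllCyclesOdd)
  open Counting

  Inj : ∀ {n} → (Fin n → Fin n) → Set
  Inj g = ∀ x y → g x ≡ g y → x ≡ y

  module _ {n : ℕ} (g : Fin n → Fin n) where
    iter-+ : ∀ a b x → iter g (a + b) x ≡ iter g a (iter g b x)
    iter-+ zero b x = refl
    iter-+ (suc a) b x = cong g (iter-+ a b x)

    iter-inj : Inj g → ∀ k {x y} → iter g k x ≡ iter g k y → x ≡ y
    iter-inj ig zero e = e
    iter-inj ig (suc k) e = iter-inj ig k (ig _ _ e)

    iter-mul : ∀ {p x} → iter g p x ≡ x → ∀ t → iter g (t * p) x ≡ x
    iter-mul e zero = refl
    iter-mul {p} {x} e (suc t) = trans (iter-+ p (t * p) x) (trans (cong (iter g p) (iter-mul e t)) e)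

    iter-diff : Inj g → ∀ {a b x} → a ≤ b → iter g a x ≡ iter g b x → iter g (b ∸ a) x ≡ x
    iter-diff ig {a} {b} {x} a≤b e = iter-inj ig a (trans (sym (iter-+ a (b ∸ a) x)) (trans (cong (λ z → iter g z x) (ℕP.m+[n∸m]≡n a≤b)) (sym e)))

    -- by pigeonhole every point returns to itself within n steps
    period : Inj g → ∀ x → ∃ λ p → (1 ≤ p) × (p ≤ n) × (iter g p x ≡ x)
    period ig x with FP.pigeonhole (ℕP.n<1+n n) (λ (k : Fin (suc n)) → iter g (toℕ k) x)
    ... | i , j , i<j , eq = (toℕ j ∸ toℕ i) , ℕP.m<n⇒0<n∸m i<j
           , ℕP.≤-trans (ℕP.m∸n≤m (toℕ j) (toℕ i)) (ℕP.≤-pred (FP.toℕ<n j))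
           , iter-diff ig (ℕP.<⇒≤ i<j) eq

    mod-red : ∀ {P x} → iter g (suc P) x ≡ x → ∀ k → iter g (k % suc P) x ≡ iter g k x
    mod-red {P} {x} e k = sym (trans (cong (λ z → iter g z x) (m≡m%n+[m/n]*n k (suc P)))
                              (trans (iter-+ (k % suc P) ((k / suc P) * suc P) x) (cong (iter g (k % suc P)) (iter-mul e (k / suc P)))))

    reduce : Inj g → ∀ k x → ∃ λ (j : Fin n) → iter g (toℕ j) x ≡ iter g k x
    reduce ig k x with period ig x
    ... | suc P , _ , P≤n , e = fromℕ< lt , trans (cong (λ z → iter g z x) (FP.toℕ-fromℕ< lt)) (mod-red e k)
      where lt : k % suc P < n
            lt = ℕP.<-≤-trans (m%n<n k (suc P)) P≤n

    Reach : Fin n → Fin n → Set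
    Reach x y = ∃ λ k → iter g k x ≡ y

    reach? : Inj g → ∀ x y → Dec (Reach x y)
    reach? ig x y with FP.any? (λ (j : Fin n) → iter g (toℕ j) x FP.≟ y)
    ... | yes (j , e) = yes (toℕ j , e)
    ... | no ne = no λ { (k , e) → ne (proj₁ (reduce ig k x) , trans (proj₂ (reduce ig k x)) e) }

    Reach-refl : ∀ x → Reach x x
    Reach-refl x = 0 , refl

    Reach-trans : ∀ {x y z} → Reach x y → Reach y z → Reach x z
    Reach-trans {x} (k1 , refl) (k2 , refl) = k2 + k1 , iter-+ k2 k1 x

    Reach-step : ∀ x → Reach x (g x)
    Reach-step x = 1 , refl

    Reach-sym : Inj g → ∀ {x y} → Reach x y → Reach y x
    Reach-sym ig {x} (k , refl) with period ig x
    ... | suc P , _ , _ , e = P * k , trans (sym (iter-+ (P * k) k x))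
          (trans (cong (λ z → iter g z x) (trans (ℕP.+-comm (P * k) k) (ℕP.*-comm (suc P) k))) (iter-mul e k))

    Min : Fin n → Set
    Min x = ∀ y → Reach x y → toℕ x ≤ toℕ y

    CM⇒Min : Inj g → ∀ {x} → IsCycleMin g x → Min x
    CM⇒Min ig {x} cm y (k , e) with reduce ig k x
    ... | j , e' = subst (λ z → toℕ x ≤ toℕ z) (trans e' e) (cm j)

    Min⇒CM : ∀ {x} → Min x → IsCycleMin g x
    Min⇒CM m k = m _ (toℕ k , refl)

    orbitSize : Inj g → Fin n → ℕ
    orbitSize ig x = count (reach? ig x) (allFin n)

    cycleLength≡orbitSize : (ig : Inj g) → ∀ {x k} → IsCycleLength g x k → orbitSize ig x ≡ k
    cycleLength≡orbitSize ig {x} {zero} (() , _)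
    cycleLength≡orbitSize ig {x} {suc K} (_ , ek , minl) =
      trans (transfer (reach? ig x) (λ (_ : Fin (suc K)) → yes tt) (allFin n) (allFin (suc K)) (allFin⁺ n) (allFin⁺ (suc K))
               ∈-allFin ∈-allFin (λ j → iter g (toℕ j) x) (λ {j} _ → toℕ j , refl) (λ {i} {j} _ _ e → injF i j e) surj)
            (trans (count-all (λ (_ : Fin (suc K)) → yes tt) (λ _ → tt) (allFin (suc K))) (length-tabulate (λ i → i)))
      where
        noRet : ∀ d → 1 ≤ d → d < suc K → iter g d x ≢ x
        noRet d 1≤d d<k e = minl (fromℕ< d<k) (subst (1 ≤_) (sym (FP.toℕ-fromℕ< d<k)) 1≤d)
                              (trans (cong (λ z → iter g z x) (FP.toℕ-fromℕ< d<k)) e)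
        injF : ∀ (i j : Fin (suc K)) → iter g (toℕ i) x ≡ iter g (toℕ j) x → i ≡ j
        injF i j e with ℕP.<-cmp (toℕ i) (toℕ j)
        ... | tri≈ _ eq _ = FP.toℕ-injective eq
        ... | tri< lt _ _ = ⊥-elim (noRet (toℕ j ∸ toℕ i) (ℕP.m<n⇒0<n∸m lt) (ℕP.≤-<-trans (ℕP.m∸n≤m (toℕ j) (toℕ i)) (FP.toℕ<n j)) (iter-diff ig (ℕP.<⇒≤ lt) e))
        ... | tri> _ _ gt = ⊥-elim (noRet (toℕ i ∸ toℕ j) (ℕP.m<n⇒0<n∸m gt) (ℕP.≤-<-trans (ℕP.m∸n≤m (toℕ i) (toℕ j)) (FP.toℕ<n i)) (iter-diff ig (ℕP.<⇒≤ gt) (sym e)))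
        surj : ∀ {y} → Reach x y → ∃ λ (j : Fin (suc K)) → ⊤ × iter g (toℕ j) x ≡ y
        surj {y} (k , e) = fromℕ< (m%n<n k (suc K)) , tt , trans (cong (λ z → iter g z x) (FP.toℕ-fromℕ< (m%n<n k (suc K)))) (trans (mod-red ek k) e)

    least : Inj g → ∀ x → ∃ λ L → L ≤ n × IsCycleLength g x L
    least ig x with period ig x
    ... | p , 1≤p , p≤n , e with search p p ℕP.≤-refl 1≤p e
      where
        search : ∀ fuel p → p ≤ fuel → 1 ≤ p → iter g p x ≡ x → ∃ λ L → L ≤ p × IsCycleLength g x L
        search zero p p≤0 1≤p e = ⊥-elim (ℕP.<⇒≱ 1≤p p≤0)
        search (suc fuel) p p≤f 1≤p e with FP.any? (λ (j : Fin p) → (1 ℕP.≤? toℕ j) ×-dec (iter g (toℕ j) x FP.≟ x))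
        ... | no ne = p , ℕP.≤-refl , 1≤p , e , (λ j 1≤j eq → ne (j , 1≤j , eq))
        ... | yes (j , 1≤j , eq) with search fuel (toℕ j) (ℕP.≤-pred (ℕP.≤-trans (FP.toℕ<n j) p≤f)) 1≤j eq
        ...   | L , L≤j , cl = L , ℕP.≤-trans L≤j (ℕP.<⇒≤ (FP.toℕ<n j)) , cl
    ... | L , L≤p , cl = L , ℕP.≤-trans L≤p p≤n , cl

    OddAll : Inj g → Set
    OddAll ig = ∀ x → orbitSize ig x % 2 ≡ 1

    odd⇒ : (ig : Inj g) → AllCyclesOdd g → OddAll ig
    odd⇒ ig ao x with least ig x
    ... | L , L≤n , cl = trans (cong (_% 2) (cycleLength≡orbitSize ig cl))
          (subst (λ z → z % 2 ≡ 1) (FP.toℕ-fromℕ< (s≤s L≤n)) (ao x (fromℕ< (s≤s L≤n)) (subst (IsCycleLength g x) (sym (FP.toℕ-fromℕ< (s≤s L≤n))) cl)))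

    odd⇐ : (ig : Inj g) → OddAll ig → AllCyclesOdd g
    odd⇐ ig oa x k cl = subst (λ z → z % 2 ≡ 1) (cycleLength≡orbitSize ig cl) (oa x)

-- Inserting a new point p into a permutation f of Fin m, giving a permutation
-- of Fin (suc m) whose other points are renamed by punchIn p:
--   insFixed f p    makes p a fixed point;
--   insAfter f p w  puts p on the cycle of w, directly after w.
-- Every permutation of Fin (suc m) arises in exactly one of these ways
-- (see Decomposition), which is the combinatorial source of the recurrences.
module Insertion where
  open import Data.Nat using (ℕ; suc)
  open import Data.Fin using (Fin; punchIn; punchOut)
  open import Data.Fin.Properties using (_≟_; punchInᵢ≢i; punchIn-injective; punchIn-punchOut; punchOut-punchIn; punchOut-cong)
  open import Data.Product using (_×_; _,_; proj₁; proj₂; ∃)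
  open import Data.Sum using (_⊎_; inj₁; inj₂)
  open import Relation.Binary.PropositionalEquality
  open import Relation.Nullary
  open import Data.Empty
  open import Function using (_∘_)
  open import Defs using (IsPerm)
  open Orbits

  perm-ext : ∀ {n} {G G' : Fin n → Fin n} → IsPerm G → (∀ y → G y ≡ G' y) → IsPerm G'
  perm-ext (inj , sur) eq = (λ x y e → inj x y (trans (eq x) (trans e (sym (eq y))))) ,
                            (λ y → proj₁ (sur y) , trans (sym (eq _)) (proj₂ (sur y)))

  module _ {m : ℕ} where
    insFixed : (Fin m → Fin m) → Fin (suc m) → Fin (suc m) → Fin (suc m)
    insFixed f p y with p ≟ y
    ... | yes _ = p
    ... | no ne = punchIn p (f (punchOut ne))

    insAfter : (Fin m → Fin m) → Fin (suc m) → Fin m → Fin (suc m) → Fin (suc m)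
    insAfter f p w y with p ≟ y
    ... | yes _ = punchIn p (f w)
    ... | no ne with punchOut ne ≟ w
    ...   | yes _ = p
    ...   | no _ = punchIn p (f (punchOut ne))

    po-pI : ∀ (p : Fin (suc m)) (x : Fin m) (ne : p ≢ punchIn p x) → punchOut ne ≡ x
    po-pI p x ne = trans (punchOut-cong p refl) (punchOut-punchIn p)

    pI≢p : ∀ (p : Fin (suc m)) (x : Fin m) → punchIn p x ≢ p
    pI≢p p x = punchInᵢ≢i p x

    split : ∀ (p y : Fin (suc m)) → (y ≡ p) ⊎ (∃ λ x → y ≡ punchIn p x)
    split p y with p ≟ y
    ... | yes e = inj₁ (sym e)
    ... | no ne = inj₂ (punchOut ne , sym (punchIn-punchOut ne))

    module _ (f : Fin m → Fin m) (p : Fin (suc m)) where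
      fix-p : insFixed f p p ≡ p
      fix-p with p ≟ p
      ... | yes _ = refl
      ... | no ne = ⊥-elim (ne refl)

      fix-pI : ∀ x → insFixed f p (punchIn p x) ≡ punchIn p (f x)
      fix-pI x with p ≟ punchIn p x
      ... | yes e = ⊥-elim (pI≢p p x (sym e))
      ... | no ne = cong (punchIn p ∘ f) (po-pI p x ne)

      module _ (w : Fin m) where
        aft-p : insAfter f p w p ≡ punchIn p (f w)
        aft-p with p ≟ p
        ... | yes _ = refl
        ... | no ne = ⊥-elim (ne refl)

        aft-w : insAfter f p w (punchIn p w) ≡ p
        aft-w with p ≟ punchIn p w
        ... | yes e = ⊥-elim (pI≢p p w (sym e))
        ... | no ne with punchOut ne ≟ w
        ...   | yes _ = refl
        ...   | no ne' = ⊥-elim (ne' (po-pI p w ne))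

        aft-x : ∀ x → x ≢ w → insAfter f p w (punchIn p x) ≡ punchIn p (f x)
        aft-x x x≢w with p ≟ punchIn p x
        ... | yes e = ⊥-elim (pI≢p p x (sym e))
        ... | no ne with punchOut ne ≟ w
        ...   | yes e = ⊥-elim (x≢w (trans (sym (po-pI p x ne)) e))
        ...   | no _ = cong (punchIn p ∘ f) (po-pI p x ne)

    module _ {f : Fin m → Fin m} {p : Fin (suc m)} where
      private
        pI : Fin m → Fin (suc m)
        pI = punchIn p
        pIinj : ∀ {x y} → pI x ≡ pI y → x ≡ y
        pIinj = punchIn-injective p _ _

      fix-perm : IsPerm f → IsPerm (insFixed f p)
      fix-perm (fi , fs) = inj , sur
        where
          G : Fin (suc m) → Fin (suc m)
          G = insFixed f p
          inj : ∀ y1 y2 → G y1 ≡ G y2 → y1 ≡ y2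
          inj y1 y2 e with split p y1 | split p y2
          ... | inj₁ refl | inj₁ refl = refl
          ... | inj₁ refl | inj₂ (x , refl) = ⊥-elim (pI≢p p (f x) (sym (trans (sym (fix-p f p)) (trans e (fix-pI f p x)))))
          ... | inj₂ (x , refl) | inj₁ refl = ⊥-elim (pI≢p p (f x) (trans (sym (fix-pI f p x)) (trans e (fix-p f p))))
          ... | inj₂ (x , refl) | inj₂ (x' , refl) = cong pI (fi x x' (pIinj (trans (sym (fix-pI f p x)) (trans e (fix-pI f p x')))))
          sur : ∀ z → ∃ λ y → G y ≡ z
          sur z with split p z
          ... | inj₁ refl = p , fix-p f p
          ... | inj₂ (y , refl) = pI (proj₁ (fs y)) , trans (fix-pI f p _) (cong pI (proj₂ (fs y)))

      fix-perm⁻ : IsPerm (insFixed f p) → IsPerm f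
      fix-perm⁻ (gi , gs) = inj , sur
        where
          G : Fin (suc m) → Fin (suc m)
          G = insFixed f p
          inj : ∀ x x' → f x ≡ f x' → x ≡ x'
          inj x x' e = pIinj (gi (pI x) (pI x') (trans (fix-pI f p x) (trans (cong pI e) (sym (fix-pI f p x')))))
          sur : ∀ y → ∃ λ x → f x ≡ y
          sur y with gs (pI y)
          ... | z , e with split p z
          ...   | inj₁ refl = ⊥-elim (pI≢p p y (sym (trans (sym (fix-p f p)) e)))
          ...   | inj₂ (x , refl) = x , pIinj (trans (sym (fix-pI f p x)) e)

      module _ {w : Fin m} where
        aft-perm : IsPerm f → IsPerm (insAfter f p w)
        aft-perm (fi , fs) = inj , sur
          where
            G : Fin (suc m) → Fin (suc m)
            G = insAfter f p w
            val : ∀ x → (x ≡ w × G (pI x) ≡ p) ⊎ (x ≢ w × G (pI x) ≡ pI (f x))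
            val x with x ≟ w
            ... | yes refl = inj₁ (refl , aft-w f p w)
            ... | no ne = inj₂ (ne , aft-x f p w x ne)
            inj : ∀ y1 y2 → G y1 ≡ G y2 → y1 ≡ y2
            inj y1 y2 e with split p y1 | split p y2
            ... | inj₁ refl | inj₁ refl = refl
            ... | inj₁ refl | inj₂ (x , refl) with val x
            ...   | inj₁ (_ , gx) = ⊥-elim (pI≢p p (f w) (trans (sym (aft-p f p w)) (trans e gx)))
            ...   | inj₂ (x≢w , gx) = ⊥-elim (x≢w (sym (fi w x (pIinj (trans (sym (aft-p f p w)) (trans e gx))))))
            inj y1 y2 e | inj₂ (x , refl) | inj₁ refl with val x
            ...   | inj₁ (_ , gx) = ⊥-elim (pI≢p p (f w) (trans (sym (aft-p f p w)) (trans (sym e) gx)))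
            ...   | inj₂ (x≢w , gx) = ⊥-elim (x≢w (sym (fi w x (pIinj (trans (sym (aft-p f p w)) (trans (sym e) gx))))))
            inj y1 y2 e | inj₂ (x , refl) | inj₂ (x' , refl) with val x | val x'
            ...   | inj₁ (refl , _) | inj₁ (refl , _) = refl
            ...   | inj₁ (_ , gx) | inj₂ (_ , gx') = ⊥-elim (pI≢p p (f x') (trans (sym gx') (trans (sym e) gx)))
            ...   | inj₂ (_ , gx) | inj₁ (_ , gx') = ⊥-elim (pI≢p p (f x) (trans (sym gx) (trans e gx')))
            ...   | inj₂ (_ , gx) | inj₂ (_ , gx') = cong pI (fi x x' (pIinj (trans (sym gx) (trans e gx'))))
            sur : ∀ z → ∃ λ y → G y ≡ z
            sur z with split p z
            ... | inj₁ refl = pI w , aft-w f p w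
            ... | inj₂ (y , refl) with fs y
            ...   | x , fx with x ≟ w
            ...     | yes refl = p , trans (aft-p f p w) (cong pI fx)
            ...     | no ne = pI x , trans (aft-x f p w x ne) (cong pI fx)

        aft-perm⁻ : IsPerm (insAfter f p w) → IsPerm f
        aft-perm⁻ (gi , gs) = inj , sur
          where
            G : Fin (suc m) → Fin (suc m)
            G = insAfter f p w
            src : Fin m → Fin (suc m)
            src x with x ≟ w
            ... | yes _ = p
            ... | no _ = pI x
            src-val : ∀ x → G (src x) ≡ pI (f x)
            src-val x with x ≟ w
            ... | yes refl = aft-p f p w
            ... | no ne = aft-x f p w x ne
            src-inj : ∀ x x' → src x ≡ src x' → x ≡ x'
            src-inj x x' e with x ≟ w | x' ≟ w
            ... | yes refl | yes refl = refl
            ... | yes _ | no _ = ⊥-elim (pI≢p p x' (sym e))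
            ... | no _ | yes _ = ⊥-elim (pI≢p p x e)
            ... | no _ | no _ = pIinj e
            inj : ∀ x x' → f x ≡ f x' → x ≡ x'
            inj x x' e = src-inj x x' (gi _ _ (trans (src-val x) (trans (cong pI e) (sym (src-val x')))))
            sur : ∀ y → ∃ λ x → f x ≡ y
            sur y with gs (pI y)
            ... | z , e with split p z
            ...   | inj₁ refl = w , pIinj (trans (sym (aft-p f p w)) e)
            ...   | inj₂ (x , refl) with x ≟ w
            ...     | yes refl = ⊥-elim (pI≢p p y (sym (trans (sym (aft-w f p w)) e)))
            ...     | no ne = x , pIinj (trans (sym (aft-x f p w x ne)) e)

module Decomposition where
  open import Data.Nat using (ℕ; suc)
  open import Data.Fin using (Fin; punchIn; punchOut)
  open import Data.Fin.Properties using (_≟_; punchIn-injective; punchIn-punchOut)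
  open import Data.Product using (_×_; _,_; proj₁; proj₂; ∃; ∃₂)
  open import Data.Sum using (inj₁; inj₂)
  open import Relation.Binary.PropositionalEquality
  open import Relation.Nullary
  open import Data.Empty
  open import Defs using (IsPerm)
  open Counting
  open Orbits
  open Insertion

  module _ {m : ℕ} {G : Fin (suc m) → Fin (suc m)} {p : Fin (suc m)} (gp : IsPerm G) where
    private
      pI : Fin m → Fin (suc m)
      pI = punchIn p
      pIinj : ∀ {x y} → pI x ≡ pI y → x ≡ y
      pIinj = punchIn-injective p _ _

    decomp-fix : G p ≡ p → ∃ λ f → IsPerm f × (∀ y → G y ≡ insFixed f p y)
    decomp-fix e = f , fix-perm⁻ {f = f} {p = p} (perm-ext gp eqv) , eqv
      where
        ne : ∀ x → p ≢ G (pI x)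
        ne x e' = pI≢p p x (proj₁ gp (pI x) p (trans (sym e') (sym e)))
        f : Fin m → Fin m
        f x = punchOut (ne x)
        eqv : ∀ y → G y ≡ insFixed f p y
        eqv y with split p y
        ... | inj₁ refl = trans e (sym (fix-p f p))
        ... | inj₂ (x , refl) = trans (sym (punchIn-punchOut (ne x))) (sym (fix-pI f p x))

    decomp-aft : G p ≢ p → ∃₂ λ f w → IsPerm f × (∀ y → G y ≡ insAfter f p w y)
    decomp-aft gp≢ with proj₂ gp p
    ... | y0 , e0 with split p y0
    ...   | inj₁ refl = ⊥-elim (gp≢ e0)
    ...   | inj₂ (w , refl) = f , w , aft-perm⁻ {f = f} {p = p} {w = w} (perm-ext gp eqv) , eqv
      where
        pne : p ≢ G p
        pne e = gp≢ (sym e)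
        fsel : (x : Fin m) → Dec (p ≡ G (pI x)) → Fin m
        fsel x (yes _) = punchOut pne
        fsel x (no n) = punchOut n
        f : Fin m → Fin m
        f x = fsel x (p ≟ G (pI x))
        fw : fsel w (p ≟ G (pI w)) ≡ punchOut pne
        fw with p ≟ G (pI w)
        ... | yes _ = refl
        ... | no n = ⊥-elim (n (sym e0))
        fx : ∀ x → x ≢ w → pI (fsel x (p ≟ G (pI x))) ≡ G (pI x)
        fx x x≢w with p ≟ G (pI x)
        ... | yes e' = ⊥-elim (x≢w (pIinj (proj₁ gp (pI x) (pI w) (trans (sym e') (sym e0)))))
        ... | no n = punchIn-punchOut n
        eqv : ∀ y → G y ≡ insAfter f p w y
        eqv y with split p y
        ... | inj₁ refl = trans (sym (punchIn-punchOut pne)) (trans (cong pI (sym fw)) (sym (aft-p f p w)))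
        ... | inj₂ (x , refl) with x ≟ w
        ...   | yes refl = trans e0 (sym (aft-w f p w))
        ...   | no x≢w = trans (sym (fx x x≢w)) (sym (aft-x f p w x x≢w))

-- Effect of the two insertions on orbits and on the number of cycles:
-- a fixed-point insertion adds one cycle, an insertion after w adds none
-- (p joins the orbit of w, which grows by one).
module InsertionCycles where
  open import Data.Nat using (ℕ; zero; suc; _+_; _≤_)
  import Data.Nat.Properties as ℕP
  open import Data.Fin using (Fin; toℕ; punchIn)
  open import Data.Fin.Properties as FP using (_≟_; punchIn-injective; punchIn-mono-≤; punchIn-cancel-≤)
  open import Data.Product using (_×_; _,_; proj₁; proj₂; ∃)
  open import Data.Sum using (_⊎_; inj₁; inj₂)
  open import Data.List using (allFin)
  open import Relation.Binary.PropositionalEquality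
  open import Relation.Nullary
  open import Relation.Nullary.Decidable using (_×-dec_; _→-dec_; ¬?)
  open import Data.Empty
  open import Defs using (iter; IsPerm; IsCycleMin; isCycleMin?; numCycles)
  open Counting
  open Orbits
  open Insertion
  open Decomposition

  orbit-min : ∀ {n} (f : Fin n → Fin n) (igf : Inj f) w → ∃ λ x0 → Reach f w x0 × (∀ y → Reach f w y → toℕ x0 ≤ toℕ y)
  orbit-min {n} f igf w = search (toℕ w) w (Reach-refl f w) ℕP.≤-refl
    where
      search : ∀ fuel c → Reach f w c → toℕ c ≤ fuel → ∃ λ x0 → Reach f w x0 × (∀ y → Reach f w y → toℕ x0 ≤ toℕ y)
      search fuel c r le with FP.any? (λ y → reach? f igf w y ×-dec (toℕ y ℕP.<? toℕ c))
      ... | no ne = c , r , λ y ry → ℕP.≮⇒≥ (λ lt → ne (y , ry , lt))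
      search zero c r le | yes (y , ry , lt) = ⊥-elim (ℕP.n≮0 (ℕP.<-≤-trans lt le))
      search (suc fuel) c r le | yes (y , ry , lt) = search fuel y ry (ℕP.≤-pred (ℕP.<-≤-trans lt le))

  -- G = insFixed f p: the orbit of p is {p}, other orbits are those of f
  module FixedOrbits {m : ℕ} (f : Fin m → Fin m) (p : Fin (suc m)) (pf : IsPerm f) where
    G : Fin (suc m) → Fin (suc m)
    G = insFixed f p
    pG : IsPerm G
    pG = fix-perm {f = f} {p = p} pf
    igG : Inj G
    igG = proj₁ pG
    igf : Inj f
    igf = proj₁ pf
    private
      pI : Fin m → Fin (suc m)
      pI = punchIn p
      pIinj : ∀ {x y} → pI x ≡ pI y → x ≡ y
      pIinj = punchIn-injective p _ _

    iter-pI : ∀ k x → iter G k (pI x) ≡ pI (iter f k x)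
    iter-pI zero x = refl
    iter-pI (suc k) x = trans (cong G (iter-pI k x)) (fix-pI f p _)

    iter-p : ∀ k → iter G k p ≡ p
    iter-p zero = refl
    iter-p (suc k) = trans (cong G (iter-p k)) (fix-p f p)

    R-pIpI⇒ : ∀ {x y} → Reach G (pI x) (pI y) → Reach f x y
    R-pIpI⇒ {x} (k , e) = k , pIinj (trans (sym (iter-pI k x)) e)
    R-pIpI⇐ : ∀ {x y} → Reach f x y → Reach G (pI x) (pI y)
    R-pIpI⇐ {x} (k , e) = k , trans (iter-pI k x) (cong pI e)
    R-pIp : ∀ {x} → ¬ Reach G (pI x) p
    R-pIp {x} (k , e) = pI≢p p _ (trans (sym (iter-pI k x)) e)
    R-p : ∀ {z} → Reach G p z → z ≡ p
    R-p (k , e) = trans (sym e) (iter-p k)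

    orbitSize-p : orbitSize G igG p ≡ 1
    orbitSize-p = trans (count-punch p (reach? G igG p)) (cong₂ _+_ (ind-yes (reach? G igG p p) (Reach-refl G p))
              (count-none (λ y → reach? G igG p (pI y)) (λ y r → pI≢p p y (R-p r)) (allFin m)))

    orbitSize-pI : ∀ x → orbitSize G igG (pI x) ≡ orbitSize f igf x
    orbitSize-pI x = trans (count-punch p (reach? G igG (pI x))) (cong₂ _+_ (ind-no (reach? G igG (pI x) p) R-pIp)
              (count-ext (λ y → reach? G igG (pI x) (pI y)) (reach? f igf x) (λ y → R-pIpI⇒) (λ y → R-pIpI⇐) (allFin m)))

    -- p is a new cycle minimum; the old minima stay minima
    cycleCount : numCycles G ≡ suc (numCycles f)
    cycleCount = trans (count-punch p (isCycleMin? G)) (cong₂ _+_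
             (ind-yes (isCycleMin? G p) (Min⇒CM G (λ z r → ℕP.≤-reflexive (cong toℕ (sym (R-p r))))))
             (count-ext (λ x → isCycleMin? G (pI x)) (isCycleMin? f) (λ x → to x) (λ x → from x) (allFin m)))
      where
        to : ∀ x → IsCycleMin G (pI x) → IsCycleMin f x
        to x cm = Min⇒CM f (λ y r → punchIn-cancel-≤ p x y (CM⇒Min G igG cm (pI y) (R-pIpI⇐ r)))
        from : ∀ x → IsCycleMin f x → IsCycleMin G (pI x)
        from x cm = Min⇒CM G mn
          where
            mn : Min G (pI x)
            mn z r with split p z
            ... | inj₁ refl = ⊥-elim (R-pIp r)
            ... | inj₂ (y , refl) = punchIn-mono-≤ p x y (CM⇒Min f igf cm y (R-pIpI⇒ r))

  -- G = insAfter f p w: the orbit of w gains p, other orbits are those of f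
  module AfterOrbits {m : ℕ} (f : Fin m → Fin m) (p : Fin (suc m)) (w : Fin m) (pf : IsPerm f) where
    G : Fin (suc m) → Fin (suc m)
    G = insAfter f p w
    pG : IsPerm G
    pG = aft-perm {f = f} {p = p} {w = w} pf
    igG : Inj G
    igG = proj₁ pG
    igf : Inj f
    igf = proj₁ pf
    private
      pI : Fin m → Fin (suc m)
      pI = punchIn p
      pIinj : ∀ {x y} → pI x ≡ pI y → x ≡ y
      pIinj = punchIn-injective p _ _

    -- one step of f on Fin m takes at most two steps of G
    step : ∀ z → Reach G (pI z) (pI (f z))
    step z with z ≟ w
    ... | yes refl = 2 , trans (cong G (aft-w f p w)) (aft-p f p w)
    ... | no ne = 1 , aft-x f p w z ne

    fwd : ∀ k x → Reach G (pI x) (pI (iter f k x))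
    fwd zero x = Reach-refl G (pI x)
    fwd (suc k) x = Reach-trans G (fwd k x) (step (iter f k x))

    R-pIpI⇐ : ∀ {x y} → Reach f x y → Reach G (pI x) (pI y)
    R-pIpI⇐ {x} (k , refl) = fwd k x

    -- the G-iterates of pI x stay on the f-orbit of x, passing through p only
    -- when that orbit contains w
    inv : ∀ j x → (∃ λ y → iter G j (pI x) ≡ pI y × Reach f x y) ⊎ (iter G j (pI x) ≡ p × Reach f x w)
    inv zero x = inj₁ (x , refl , Reach-refl f x)
    inv (suc j) x with inv j x
    ... | inj₁ (y , e , r) with y ≟ w
    ...   | yes refl = inj₂ (trans (cong G e) (aft-w f p w) , r)
    ...   | no ne = inj₁ (f y , trans (cong G e) (aft-x f p w y ne) , Reach-trans f r (Reach-step f y))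
    inv (suc j) x | inj₂ (e , r) = inj₁ (f w , trans (cong G e) (aft-p f p w) , Reach-trans f r (Reach-step f w))

    R-pIpI⇒ : ∀ {x y} → Reach G (pI x) (pI y) → Reach f x y
    R-pIpI⇒ {x} {y} (j , e) with inv j x
    ... | inj₁ (y' , e' , r) = subst (Reach f x) (pIinj (trans (sym e') e)) r
    ... | inj₂ (e' , r) = ⊥-elim (pI≢p p y (trans (sym e) e'))

    R-pIp⇒ : ∀ {x} → Reach G (pI x) p → Reach f x w
    R-pIp⇒ {x} (j , e) with inv j x
    ... | inj₁ (y' , e' , r) = ⊥-elim (pI≢p p y' (trans (sym e') e))
    ... | inj₂ (e' , r) = r

    R-pIp⇐ : ∀ {x} → Reach f x w → Reach G (pI x) p
    R-pIp⇐ r = Reach-trans G (R-pIpI⇐ r) (1 , aft-w f p w)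

    R-ppI⇒ : ∀ {y} → Reach G p (pI y) → Reach f w y
    R-ppI⇒ r = R-pIpI⇒ (Reach-trans G (1 , aft-w f p w) r)

    R-ppI⇐ : ∀ {y} → Reach f w y → Reach G p (pI y)
    R-ppI⇐ r = Reach-trans G (Reach-sym G igG (1 , aft-w f p w)) (R-pIpI⇐ r)

    orbitSize-pI : ∀ x → orbitSize G igG (pI x) ≡ ind (reach? f igf x w) + orbitSize f igf x
    orbitSize-pI x = trans (count-punch p (reach? G igG (pI x))) (cong₂ _+_
        (ind-ext (reach? G igG (pI x) p) (reach? f igf x w) R-pIp⇒ R-pIp⇐)
        (count-ext (λ y → reach? G igG (pI x) (pI y)) (reach? f igf x) (λ y → R-pIpI⇒) (λ y → R-pIpI⇐) (allFin m)))

    orbitSize-p : orbitSize G igG p ≡ suc (orbitSize f igf w)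
    orbitSize-p = trans (count-punch p (reach? G igG p)) (cong₂ _+_ (ind-yes (reach? G igG p p) (Reach-refl G p))
        (count-ext (λ y → reach? G igG p (pI y)) (reach? f igf w) (λ y → R-ppI⇒) (λ y → R-ppI⇐) (allFin m)))

    -- the minimum of the orbit of w in G is p or the old minimum x0, never
    -- both, so the number of minima does not change
    cycleCount : numCycles G ≡ numCycles f
    cycleCount with orbit-min f igf w
    ... | x0 , r0 , mn0 = begin
        numCycles G
      ≡⟨ count-punch p (isCycleMin? G) ⟩
        ind (isCycleMin? G p) + count (λ x → isCycleMin? G (pI x)) (allFin m)
      ≡⟨ cong₂ _+_ (ind-ext (isCycleMin? G p) pFirst? p-min⇒ p-min⇐) (count-ext (λ x → isCycleMin? G (pI x)) (λ x → isCycleMin? f x ×-dec belowP? x) (λ x → pI-min⇒ x) (λ x → pI-min⇐ x) (allFin m)) ⟩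
        ind pFirst? + count (λ x → isCycleMin? f x ×-dec belowP? x) (allFin m)
      ≡⟨ ℕP.+-comm (ind pFirst?) _ ⟩
        count (λ x → isCycleMin? f x ×-dec belowP? x) (allFin m) + ind pFirst?
      ≡⟨ cong (count (λ x → isCycleMin? f x ×-dec belowP? x) (allFin m) +_) (sym lost-minima) ⟩
        count (λ x → isCycleMin? f x ×-dec belowP? x) (allFin m) + count (λ x → isCycleMin? f x ×-dec ¬? (belowP? x)) (allFin m)
      ≡⟨ sym (count-split (isCycleMin? f) belowP? (allFin m)) ⟩
        numCycles f
      ∎ where
        open ≡-Reasoning
        PFirst : Set
        PFirst = toℕ p ≤ toℕ (pI x0)
        pFirst? : Dec PFirst
        pFirst? = toℕ p ℕP.≤? toℕ (pI x0)
        -- a point of the orbit of w stays a minimum only if it precedes p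
        BelowP : Fin m → Set
        BelowP x = Reach f x w → toℕ (pI x) ≤ toℕ p
        belowP? : ∀ x → Dec (BelowP x)
        belowP? x = reach? f igf x w →-dec (toℕ (pI x) ℕP.≤? toℕ p)
        p-min⇒ : IsCycleMin G p → PFirst
        p-min⇒ cm = CM⇒Min G igG cm (pI x0) (R-ppI⇐ r0)
        p-min⇐ : PFirst → IsCycleMin G p
        p-min⇐ d = Min⇒CM G mn
          where
            mn : Min G p
            mn z r with split p z
            ... | inj₁ refl = ℕP.≤-refl
            ... | inj₂ (y , refl) = ℕP.≤-trans d (punchIn-mono-≤ p x0 y (mn0 y (R-ppI⇒ r)))
        pI-min⇒ : ∀ x → IsCycleMin G (pI x) → IsCycleMin f x × BelowP x
        pI-min⇒ x cm = Min⇒CM f (λ y r → punchIn-cancel-≤ p x y (CM⇒Min G igG cm (pI y) (R-pIpI⇐ r))) ,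
                  (λ r → CM⇒Min G igG cm p (R-pIp⇐ r))
        pI-min⇐ : ∀ x → IsCycleMin f x × BelowP x → IsCycleMin G (pI x)
        pI-min⇐ x (cm , rr) = Min⇒CM G mn
          where
            mn : Min G (pI x)
            mn z r with split p z
            ... | inj₁ refl = rr (R-pIp⇒ r)
            ... | inj₂ (y , refl) = punchIn-mono-≤ p x y (CM⇒Min f igf cm y (R-pIpI⇒ r))
        w-orbit-min : ∀ x → IsCycleMin f x → Reach f x w → x ≡ x0
        w-orbit-min x cm r = FP.toℕ-injective (ℕP.≤-antisym (CM⇒Min f igf cm x0 (Reach-trans f r r0)) (mn0 x (Reach-sym f igf r)))
        lost-min⇒ : ∀ x → IsCycleMin f x × ¬ BelowP x → x ≡ x0 × PFirst
        lost-min⇒ x (cm , nrr) with reach? f igf x w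
        ... | no nr = ⊥-elim (nrr (λ r → ⊥-elim (nr r)))
        ... | yes r with w-orbit-min x cm r
        ...   | refl = refl , ℕP.<⇒≤ (ℕP.≰⇒> (λ le → nrr (λ _ → le)))
        lost-min⇐ : ∀ x → x ≡ x0 × PFirst → IsCycleMin f x × ¬ BelowP x
        lost-min⇐ x (refl , d) = Min⇒CM f (λ y r → mn0 y (Reach-trans f r0 r)) ,
          (λ rr → pI≢p p x0 (FP.toℕ-injective (ℕP.≤-antisym (rr (Reach-sym f igf r0)) d)))
        lost-minima : count (λ x → isCycleMin? f x ×-dec ¬? (belowP? x)) (allFin m) ≡ ind pFirst?
        lost-minima with pFirst?
        ... | yes d = trans (count-ext (λ x → isCycleMin? f x ×-dec ¬? (belowP? x)) (λ x → x ≟ x0) (λ x h → proj₁ (lost-min⇒ x h)) (λ x e → lost-min⇐ x (e , d)) (allFin m)) (count-single x0)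
        ... | no nd = count-none (λ x → isCycleMin? f x ×-dec ¬? (belowP? x)) (λ x h → nd (proj₂ (lost-min⇒ x h))) (allFin m)

-- The double insertion
-- (TwoPointInsertion) adds two points to one cycle, so it preserves and reflects
-- the property that all cycles are odd; a single fixed-point insertion adds a
-- cycle of length 1.
module InsertionParity where
  open import Data.Nat using (ℕ; zero; suc; _+_; _*_; _≤_; _%_)
  import Data.Nat.Properties as ℕP
  open import Data.Nat.DivMod using ([m+kn]%n≡m%n)
  open import Data.Fin as F using (Fin; toℕ; punchIn)
  open import Data.Fin.Properties using (_≟_; punchIn-injective)
  open import Data.Product using (_×_; _,_)
  open import Data.Sum using (inj₁; inj₂)
  open import Data.List using (allFin)
  open import Relation.Binary.PropositionalEquality
  open import Relation.Nullary
  open import Data.Empty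
  open import Defs using (iter; IsPerm; IsCycleMin; isCycleMin?; numCycles; IsCycleLength; AllCyclesOdd)
  open Counting
  open Orbits
  open Insertion
  open Decomposition
  open InsertionCycles

  module _ {n : ℕ} {G G' : Fin n → Fin n} (eq : ∀ y → G y ≡ G' y) where
    iter-ext : ∀ k x → iter G k x ≡ iter G' k x
    iter-ext zero x = refl
    iter-ext (suc k) x = trans (eq _) (cong G' (iter-ext k x))

    cm-ext : ∀ {x} → IsCycleMin G x → IsCycleMin G' x
    cm-ext {x} cm k = subst (λ z → toℕ x ≤ toℕ z) (iter-ext (toℕ k) x) (cm k)

    cl-ext : ∀ {x k} → IsCycleLength G x k → IsCycleLength G' x k
    cl-ext {x} {k} (a , e , mn) = a , trans (sym (iter-ext k x)) e , (λ j 1≤j e' → mn j 1≤j (trans (iter-ext (toℕ j) x) e'))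

  module _ {n : ℕ} {G G' : Fin n → Fin n} (eq : ∀ y → G y ≡ G' y) where
    private eq' : ∀ y → G' y ≡ G y
            eq' y = sym (eq y)
    numCycles-ext : numCycles G ≡ numCycles G'
    numCycles-ext = count-ext (isCycleMin? G) (isCycleMin? G') (λ _ → cm-ext eq) (λ _ → cm-ext eq') (allFin n)

    odd-ext : AllCyclesOdd G → AllCyclesOdd G'
    odd-ext ao x k cl = ao x k (cl-ext eq' cl)

  module _ {m : ℕ} {p : Fin (suc m)} where
    private
      pI : Fin m → Fin (suc m)
      pI = punchIn p
      pIinj : ∀ {x y} → pI x ≡ pI y → x ≡ y
      pIinj = punchIn-injective p _ _

    fix-ext : ∀ {f f' : Fin m → Fin m} → (∀ x → f x ≡ f' x) → ∀ y → insFixed f p y ≡ insFixed f' p y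
    fix-ext {f} {f'} eq y with split p y
    ... | inj₁ refl = trans (fix-p f p) (sym (fix-p f' p))
    ... | inj₂ (x , refl) = trans (fix-pI f p x) (trans (cong pI (eq x)) (sym (fix-pI f' p x)))

    aft-ext : ∀ {f f' : Fin m → Fin m} {w} → (∀ x → f x ≡ f' x) → ∀ y → insAfter f p w y ≡ insAfter f' p w y
    aft-ext {f} {f'} {w} eq y with split p y
    ... | inj₁ refl = trans (aft-p f p w) (trans (cong pI (eq w)) (sym (aft-p f' p w)))
    ... | inj₂ (x , refl) with x ≟ w
    ...   | yes refl = trans (aft-w f p w) (sym (aft-w f' p w))
    ...   | no ne = trans (aft-x f p w x ne) (trans (cong pI (eq x)) (sym (aft-x f' p w x ne)))

    fix-inj : ∀ {f f' : Fin m → Fin m} → (∀ y → insFixed f p y ≡ insFixed f' p y) → ∀ x → f x ≡ f' x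
    fix-inj {f} {f'} h x = pIinj (trans (sym (fix-pI f p x)) (trans (h (pI x)) (fix-pI f' p x)))

    aft-inj : ∀ {f f' : Fin m → Fin m} {w w'} → (∀ y → insAfter f p w y ≡ insAfter f' p w' y) → w ≡ w' × (∀ x → f x ≡ f' x)
    aft-inj {f} {f'} {w} {w'} h with w ≟ w'
    ... | no ne = ⊥-elim (pI≢p p (f' w) (sym (trans (sym (aft-w f p w)) (trans (h (pI w)) (aft-x f' p w' w ne)))))
    ... | yes refl = refl , fx
      where
        fx : ∀ x → f x ≡ f' x
        fx x with x ≟ w
        ... | yes refl = pIinj (trans (sym (aft-p f p w)) (trans (h p) (aft-p f' p w)))
        ... | no ne = pIinj (trans (sym (aft-x f p w x ne)) (trans (h (pI x)) (aft-x f' p w x ne)))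

  parity-+2 : ∀ a → suc (suc a) % 2 ≡ a % 2
  parity-+2 a = trans (cong (_% 2) (ℕP.+-comm 2 a)) ([m+kn]%n≡m%n a 1 2)

  parity-+2i : ∀ i a → (i + (i + a)) % 2 ≡ a % 2
  parity-+2i i a = trans (cong (_% 2) (regroup i a)) ([m+kn]%n≡m%n a i 2)
    where regroup : ∀ i a → i + (i + a) ≡ a + i * 2
          regroup i a = trans (sym (ℕP.+-assoc i i a)) (trans (ℕP.+-comm (i + i) a) (cong (a +_) (trans (cong (i +_) (sym (ℕP.+-identityʳ i))) (ℕP.*-comm 2 i))))

  -- a fixed point is an odd cycle
  module FixedParity {m : ℕ} (f : Fin m → Fin m) (p : Fin (suc m)) (pf : IsPerm f) where
    open FixedOrbits f p pf
    odd⇒' : AllCyclesOdd f → AllCyclesOdd G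
    odd⇒' ao = odd⇐ G igG h
      where
        h : OddAll G igG
        h y with split p y
        ... | inj₁ refl = cong (_% 2) orbitSize-p
        ... | inj₂ (x , refl) = trans (cong (_% 2) (orbitSize-pI x)) (odd⇒ f igf ao x)
    odd⇐' : AllCyclesOdd G → AllCyclesOdd f
    odd⇐' ao = odd⇐ f igf (λ x → trans (cong (_% 2) (sym (orbitSize-pI x))) (odd⇒ G igG ao (punchIn p x)))

  -- σ: insert u after w into τ, then insert 0 after (the new name of) w;
  -- the cycle of w gains the two points u and 0
  module TwoPointInsertion {m : ℕ} (τ : Fin m → Fin m) (u : Fin (suc m)) (w : Fin m) (pτ : IsPerm τ) where
    module A1 = AfterOrbits τ u w pτ
    ρ : Fin (suc m) → Fin (suc m)
    ρ = A1.G
    w' : Fin (suc m)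
    w' = punchIn u w
    module A2 = AfterOrbits ρ F.zero w' A1.pG
    σ : Fin (suc (suc m)) → Fin (suc (suc m))
    σ = A2.G

    reach-uw' : Reach ρ u w'
    reach-uw' = A1.R-ppI⇐ (Reach-refl τ w)

    orbitSize-0 : orbitSize σ A2.igG F.zero ≡ suc (suc (orbitSize τ A1.igf w))
    orbitSize-0 = trans A2.orbitSize-p (cong suc (trans (A1.orbitSize-pI w) (cong (_+ orbitSize τ A1.igf w) (ind-yes (reach? τ A1.igf w w) (Reach-refl τ w)))))

    orbitSize-u : orbitSize σ A2.igG (F.suc u) ≡ suc (suc (orbitSize τ A1.igf w))
    orbitSize-u = trans (A2.orbitSize-pI u) (cong₂ _+_ (ind-yes (reach? ρ A1.igG u w') reach-uw') A1.orbitSize-p)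

    orbitSize-x : ∀ x → orbitSize σ A2.igG (F.suc (punchIn u x)) ≡ ind (reach? τ A1.igf x w) + (ind (reach? τ A1.igf x w) + orbitSize τ A1.igf x)
    orbitSize-x x = trans (A2.orbitSize-pI (punchIn u x)) (cong₂ _+_ (ind-ext (reach? ρ A1.igG (punchIn u x) w') (reach? τ A1.igf x w) A1.R-pIpI⇒ A1.R-pIpI⇐) (A1.orbitSize-pI x))

    oddD⇒ : AllCyclesOdd τ → AllCyclesOdd σ
    oddD⇒ ao = odd⇐ σ A2.igG h
      where
        oτ : OddAll τ A1.igf
        oτ = odd⇒ τ A1.igf ao
        h : OddAll σ A2.igG
        h y with split F.zero y
        ... | inj₁ refl = trans (cong (_% 2) orbitSize-0) (trans (parity-+2 (orbitSize τ A1.igf w)) (oτ w))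
        ... | inj₂ (y' , refl) with split u y'
        ...   | inj₁ refl = trans (cong (_% 2) orbitSize-u) (trans (parity-+2 (orbitSize τ A1.igf w)) (oτ w))
        ...   | inj₂ (x , refl) = trans (cong (_% 2) (orbitSize-x x)) (trans (parity-+2i (ind (reach? τ A1.igf x w)) _) (oτ x))

    oddD⇐ : AllCyclesOdd σ → AllCyclesOdd τ
    oddD⇐ ao = odd⇐ τ A1.igf (λ x → trans (sym (parity-+2i (ind (reach? τ A1.igf x w)) _)) (trans (cong (_% 2) (sym (orbitSize-x x))) (odd⇒ σ A2.igG ao (F.suc (punchIn u x)))))

    cycleCount : numCycles σ ≡ numCycles τ
    cycleCount = trans A2.cycleCount A1.cycleCount

  insAfter-fixed-even : ∀ {m} (ρ : Fin m → Fin m) (p : Fin (suc m)) (w : Fin m) → IsPerm ρ →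
    ρ w ≡ w → ¬ AllCyclesOdd (insAfter ρ p w)
  insAfter-fixed-even {m} ρ p w pρ fixed odd = ℕP.0≢1+n (trans (sym (cong (_% 2) size2)) (odd⇒ G igG odd p))
    where
      open AfterOrbits ρ p w pρ
      iter-fixed : ∀ j → iter ρ j w ≡ w
      iter-fixed zero = refl
      iter-fixed (suc j) = trans (cong ρ (iter-fixed j)) fixed
      size1 : orbitSize ρ igf w ≡ 1
      size1 = trans (count-ext (reach? ρ igf w) (λ z → z ≟ w) (λ { z (j , e) → trans (sym e) (iter-fixed j) })
                      (λ { z refl → Reach-refl ρ w }) (allFin m))
                    (count-single w)
      size2 : orbitSize G igG p ≡ 2
      size2 = trans orbitSize-p (cong suc size1)

-- CountFixing0 and CountMoving0 count the tables of
-- permutations of Fin (suc m) with a property R' that fix 0, respectively move 0,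
-- through the bijections f ↦ insFixed f 0 and (w, f) ↦ insAfter f 0 w, provided
-- R' on the inserted permutation corresponds to R on the original one.
module Enumeration where
  open import Data.Nat using (ℕ; zero; suc; _*_)
  open import Data.Fin as F using (Fin)
  open import Data.Fin.Properties using (_≟_)
  open import Data.Vec using (Vec; lookup; tabulate; _∷_; [])
  open import Data.Vec.Properties using (lookup∘tabulate; tabulate∘lookup; tabulate-cong)
  open import Data.Product using (_×_; _,_; ∃)
  open import Data.List as L using ([]; _∷_; allFin; map; concatMap; cartesianProduct; cartesianProductWith; length)
  open import Data.List.Properties using (length-tabulate)
  open import Data.List.Membership.Propositional using (_∈_)
  open import Data.List.Membership.Propositional.Properties using (∈-allFin; ∈-cartesianProductWith⁺; ∈-cartesianProduct⁺)
  open import Data.List.Relation.Unary.Any using (here)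
  import Data.List.Relation.Unary.Unique.Propositional.Properties as UP
  open import Data.List.Relation.Unary.Unique.Propositional using (Unique)
  open import Data.List.Relation.Unary.AllPairs using ([]; _∷_)
  import Data.List.Relation.Unary.All as All
  open import Relation.Binary.PropositionalEquality
  open import Relation.Nullary
  open import Relation.Nullary.Decidable using (_×-dec_; ¬?)
  open import Data.Empty
  open import Function using (id)
  open import Defs
  open Counting
  open Orbits
  open Insertion
  open Decomposition
  open InsertionCycles
  open InsertionParity

  vecs-cp : ∀ m k → vecs m (suc k) ≡ cartesianProductWith _∷_ (allFin m) (vecs m k)
  vecs-cp m k = go (allFin m)
    where go : ∀ L → concatMap (λ a → map (a ∷_) (vecs m k)) L ≡ cartesianProductWith _∷_ L (vecs m k)
          go [] = refl
          go (x ∷ L) = cong (map (x ∷_) (vecs m k) L.++_) (go L)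

  vecs-complete : ∀ m k (v : Vec (Fin m) k) → v ∈ vecs m k
  vecs-complete m zero [] = here refl
  vecs-complete m (suc k) (a ∷ v) = subst (λ L → (a ∷ v) ∈ L) (sym (vecs-cp m k)) (∈-cartesianProductWith⁺ _∷_ (∈-allFin a) (vecs-complete m k v))

  vecs-unique : ∀ m k → Unique (vecs m k)
  vecs-unique m zero = All.[] ∷ []
  vecs-unique m (suc k) = subst Unique (sym (vecs-cp m k))
    (UP.cartesianProductWith⁺ _∷_ (λ { refl → refl , refl }) (UP.allFin⁺ m) (vecs-unique m k))

  vec-ext : ∀ {m k} {v v' : Vec (Fin m) k} → (∀ x → lookup v x ≡ lookup v' x) → v ≡ v'
  vec-ext {v = v} {v'} h = trans (sym (tabulate∘lookup v)) (trans (tabulate-cong h) (tabulate∘lookup v'))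

  lt-eq : ∀ {n} (g : Fin n → Fin n) y → g y ≡ lookup (tabulate g) y
  lt-eq g y = sym (lookup∘tabulate g y)

  length-allFin : ∀ m → length (allFin m) ≡ m
  length-allFin m = length-tabulate id

  module CountFixing0 (m : ℕ)
    {R : (Fin m → Fin m) → Set} (R? : ∀ f → Dec (R f))
    {R' : (Fin (suc m) → Fin (suc m)) → Set} (R'? : ∀ f → Dec (R' f))
    (R'-ext : ∀ {G G'} → (∀ y → G y ≡ G' y) → R' G → R' G')
    (R-ext : ∀ {f f'} → (∀ y → f y ≡ f' y) → R f → R f')
    (to : ∀ f → IsPerm f → R f → R' (insFixed f F.zero))
    (from : ∀ f → IsPerm f → R' (insFixed f F.zero) → R f) where

    Pfix? : (v : Vec (Fin (suc m)) (suc m)) → Dec ((IsPerm (lookup v) × R' (lookup v)) × lookup v F.zero ≡ F.zero)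
    Pfix? v = (isPerm? (lookup v) ×-dec R'? (lookup v)) ×-dec (lookup v F.zero ≟ F.zero)
    Q? : (t : Vec (Fin m) m) → Dec (IsPerm (lookup t) × R (lookup t))
    Q? t = isPerm? (lookup t) ×-dec R? (lookup t)

    φ : Vec (Fin m) m → Vec (Fin (suc m)) (suc m)
    φ t = tabulate (insFixed (lookup t) F.zero)

    result : count Pfix? (vecs (suc m) (suc m)) ≡ count Q? (vecs m m)
    result = transfer Pfix? Q? (vecs _ _) (vecs _ _) (vecs-unique _ _) (vecs-unique _ _) (vecs-complete _ _) (vecs-complete _ _) φ (λ {t} → pres {t}) (λ {t} {t'} → inj {t} {t'}) surj
      where
        pres : ∀ {t} → IsPerm (lookup t) × R (lookup t) → (IsPerm (lookup (φ t)) × R' (lookup (φ t))) × lookup (φ t) F.zero ≡ F.zero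
        pres {t} (pt , rt) = (perm-ext (fix-perm {f = lookup t} {p = F.zero} pt) (lt-eq (insFixed (lookup t) F.zero)) , R'-ext (lt-eq (insFixed (lookup t) F.zero)) (to (lookup t) pt rt)) ,
                             trans (sym (lt-eq (insFixed (lookup t) F.zero) F.zero)) (fix-p (lookup t) F.zero)
        inj : ∀ {t t'} → _ → _ → φ t ≡ φ t' → t ≡ t'
        inj {t} {t'} _ _ e = vec-ext (fix-inj {p = F.zero} (λ y → trans (lt-eq (insFixed (lookup t) F.zero) y) (trans (cong (λ v → lookup v y) e) (sym (lt-eq (insFixed (lookup t') F.zero) y)))))
        surj : ∀ {v} → (IsPerm (lookup v) × R' (lookup v)) × lookup v F.zero ≡ F.zero → ∃ λ t → (IsPerm (lookup t) × R (lookup t)) × φ t ≡ v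
        surj {v} ((pv , rv) , fv) with decomp-fix {p = F.zero} pv fv
        ... | f , pf , eqv = tabulate f , (perm-ext pf (lt-eq f) , R-ext (lt-eq f) (from f pf (R'-ext eqv rv))) ,
              vec-ext (λ y → trans (sym (lt-eq (insFixed (lookup (tabulate f)) F.zero) y)) (trans (fix-ext {p = F.zero} (λ x → sym (lt-eq f x)) y) (sym (eqv y))))

  module CountMoving0 (m : ℕ)
    {R : (Fin m → Fin m) → Set} (R? : ∀ f → Dec (R f))
    {R' : (Fin (suc m) → Fin (suc m)) → Set} (R'? : ∀ f → Dec (R' f))
    (R'-ext : ∀ {G G'} → (∀ y → G y ≡ G' y) → R' G → R' G')
    (R-ext : ∀ {f f'} → (∀ y → f y ≡ f' y) → R f → R f')
    (to : ∀ f w → IsPerm f → R f → R' (insAfter f F.zero w))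
    (from : ∀ f w → IsPerm f → R' (insAfter f F.zero w) → R f) where

    Paft? : (v : Vec (Fin (suc m)) (suc m)) → Dec ((IsPerm (lookup v) × R' (lookup v)) × lookup v F.zero ≢ F.zero)
    Paft? v = (isPerm? (lookup v) ×-dec R'? (lookup v)) ×-dec ¬? (lookup v F.zero ≟ F.zero)
    Q? : (t : Vec (Fin m) m) → Dec (IsPerm (lookup t) × R (lookup t))
    Q? t = isPerm? (lookup t) ×-dec R? (lookup t)
    Q2 : Fin m × Vec (Fin m) m → Set
    Q2 (w , t) = IsPerm (lookup t) × R (lookup t)
    Q2? : (b : Fin m × Vec (Fin m) m) → Dec (Q2 b)
    Q2? (w , t) = Q? t

    φ : Fin m × Vec (Fin m) m → Vec (Fin (suc m)) (suc m)
    φ (w , t) = tabulate (insAfter (lookup t) F.zero w)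

    result0 : count Paft? (vecs (suc m) (suc m)) ≡ count Q2? (cartesianProduct (allFin m) (vecs m m))
    result0 = transfer Paft? Q2? (vecs _ _) (cartesianProduct (allFin m) (vecs m m)) (vecs-unique _ _)
        (UP.cartesianProduct⁺ (UP.allFin⁺ m) (vecs-unique m m)) (vecs-complete _ _)
        (λ { (w , t) → ∈-cartesianProduct⁺ (∈-allFin w) (vecs-complete m m t) }) φ (λ {b} → pres b) (λ {b} {b'} → inj b b') surj
      where
        pres : ∀ b → Q2 b → (IsPerm (lookup (φ b)) × R' (lookup (φ b))) × ¬ (lookup (φ b) F.zero ≡ F.zero)
        pres (w , t) (pt , rt) = (perm-ext (aft-perm {f = lookup t} {p = F.zero} {w = w} pt) (lt-eq (insAfter (lookup t) F.zero w)) , R'-ext (lt-eq (insAfter (lookup t) F.zero w)) (to (lookup t) w pt rt)) ,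
                             (λ e → pI≢p F.zero (lookup t w) (trans (sym (aft-p (lookup t) F.zero w)) (trans (lt-eq (insAfter (lookup t) F.zero w) F.zero) e)))
        inj : ∀ b b' → _ → _ → φ b ≡ φ b' → b ≡ b'
        inj (w , t) (w' , t') _ _ e with aft-inj {p = F.zero} {f = lookup t} {f' = lookup t'} {w = w} {w' = w'} (λ y → trans (lt-eq (insAfter (lookup t) F.zero w) y) (trans (cong (λ v → lookup v y) e) (sym (lt-eq (insAfter (lookup t') F.zero w') y))))
        ... | refl , h = cong (w ,_) (vec-ext h)
        surj : ∀ {v} → (IsPerm (lookup v) × R' (lookup v)) × ¬ (lookup v F.zero ≡ F.zero) → ∃ λ b → Q2 b × φ b ≡ v
        surj {v} ((pv , rv) , nf) with decomp-aft {p = F.zero} pv nf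
        ... | f , w , pf , eqv = (w , tabulate f) , (perm-ext pf (lt-eq f) , R-ext (lt-eq f) (from f w pf (R'-ext eqv rv))) ,
              vec-ext (λ y → trans (sym (lt-eq (insAfter (lookup (tabulate f)) F.zero w) y)) (trans (aft-ext {p = F.zero} {w = w} (λ x → sym (lt-eq f x)) y) (sym (eqv y))))

    result : count Paft? (vecs (suc m) (suc m)) ≡ m * count Q? (vecs m m)
    result = trans result0 (trans (count-cart Q2? (allFin m) (vecs m m))
      (trans (sumL-const (λ w → count (λ t → Q2? (w , t)) (vecs m m)) (count Q? (vecs m m)) (λ _ → refl) (allFin m)) (cong (_* count Q? (vecs m m)) (length-allFin m))))

-- With cyc m i = c(m,i) and oddPerms m k = A(m,k)
-- (permutations of [m] with k cycles, all odd):
--   c(m+1,i+1) = c(m,i) + m c(m,i+1),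
--   A(m+2,k+1) = A(m+1,k) + (m+1) m A(m,k+1).
-- In the second, a permutation moving 0 is built uniquely from u ∈ Fin (m+1),
-- w ∈ Fin m and an odd permutation of Fin m by the double insertion of
-- TwoPointInsertion: 0 cannot sit in a cycle of length 2, so removing 0 and
-- then its image again leaves an odd permutation.
module Recurrences where
  open import Data.Nat using (ℕ; zero; suc; _+_; _*_; z≤n)
  import Data.Nat.Properties as ℕP
  open import Data.Fin as F using (Fin; punchIn)
  open import Data.Fin.Properties using (_≟_)
  open import Data.Vec using (Vec; lookup; tabulate; _∷_; [])
  open import Data.Product using (_×_; _,_; proj₁; proj₂; ∃)
  open import Data.List using (List; []; _∷_; allFin; cartesianProduct)
  open import Data.List.Membership.Propositional.Properties using (∈-allFin; ∈-cartesianProduct⁺)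
  import Data.List.Relation.Unary.Unique.Propositional.Properties as UP
  open import Relation.Binary.PropositionalEquality
  open import Relation.Nullary
  open import Relation.Nullary.Decidable using (_×-dec_; ¬?)
  open import Data.Empty
  open import Defs
  open Counting
  open Orbits
  open Insertion
  open Decomposition
  open InsertionCycles
  open InsertionParity
  open Enumeration

  HasCycles : ∀ {n} → ℕ → (Fin n → Fin n) → Set
  HasCycles i f = numCycles f ≡ i
  hasCycles? : ∀ {n} i (f : Fin n → Fin n) → Dec (HasCycles i f)
  hasCycles? i f = numCycles f ℕP.≟ i

  OddWithCycles : ∀ {n} → ℕ → (Fin n → Fin n) → Set
  OddWithCycles k f = numCycles f ≡ k × AllCyclesOdd f
  oddWithCycles? : ∀ {n} k (f : Fin n → Fin n) → Dec (OddWithCycles k f)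
  oddWithCycles? k f = (numCycles f ℕP.≟ k) ×-dec allCyclesOdd? f

  HasCycles-ext : ∀ {n i} {G G' : Fin n → Fin n} → (∀ y → G y ≡ G' y) → HasCycles i G → HasCycles i G'
  HasCycles-ext eq r = trans (sym (numCycles-ext eq)) r

  OddWithCycles-ext : ∀ {n k} {G G' : Fin n → Fin n} → (∀ y → G y ≡ G' y) → OddWithCycles k G → OddWithCycles k G'
  OddWithCycles-ext eq (r , o) = trans (sym (numCycles-ext eq)) r , odd-ext eq o

  cyc : ℕ → ℕ → ℕ
  cyc m i = count (λ v → isPerm? (lookup v) ×-dec hasCycles? i (lookup v)) (vecs m m)

  oddPerms : ℕ → ℕ → ℕ
  oddPerms m k = count (λ v → isPerm? (lookup v) ×-dec oddWithCycles? k (lookup v)) (vecs m m)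

  c≡cyc : ∀ m i → c m i ≡ cyc m i
  c≡cyc m i = count-ff (λ v → isPerm? (lookup v)) (λ v → numCycles (lookup v) ℕP.≟ i) (vecs m m)

  -- the Stirling recurrence: split by whether 0 is fixed
  cyc-rec : ∀ m i → cyc (suc m) (suc i) ≡ cyc m i + m * cyc m (suc i)
  cyc-rec m i = trans (count-split (λ v → isPerm? (lookup v) ×-dec hasCycles? (suc i) (lookup v)) (λ v → lookup v F.zero ≟ F.zero) (vecs (suc m) (suc m)))
    (cong₂ _+_ (CountFixing0.result m (hasCycles? i) (hasCycles? (suc i)) HasCycles-ext HasCycles-ext
                  (λ f pf r → trans (FixedOrbits.cycleCount f F.zero pf) (cong suc r))
                  (λ f pf r → ℕP.suc-injective (trans (sym (FixedOrbits.cycleCount f F.zero pf)) r)))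
               (CountMoving0.result m (hasCycles? (suc i)) (hasCycles? (suc i)) HasCycles-ext HasCycles-ext
                  (λ f w pf r → trans (AfterOrbits.cycleCount f F.zero w pf) r)
                  (λ f w pf r → trans (sym (AfterOrbits.cycleCount f F.zero w pf)) r)))

  numCycles-pos : ∀ {m} (f : Fin (suc m) → Fin (suc m)) → numCycles f ≢ 0
  numCycles-pos {m} f e with trans (sym e) (count-suc (isCycleMin? f))
  ... | e' = ℕP.0≢1+n (trans e' (cong (_+ count (λ x → isCycleMin? f (F.suc x)) (allFin m)) (ind-yes (isCycleMin? f F.zero) (λ k → z≤n))))

  cyc-s0 : ∀ m → cyc (suc m) 0 ≡ 0
  cyc-s0 m = count-none (λ v → isPerm? (lookup v) ×-dec hasCycles? 0 (lookup v)) (λ v h → numCycles-pos (lookup v) (proj₂ h)) (vecs (suc m) (suc m))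

  oddPerms-s0 : ∀ m → oddPerms (suc m) 0 ≡ 0
  oddPerms-s0 m = count-none (λ v → isPerm? (lookup v) ×-dec oddWithCycles? 0 (lookup v)) (λ v h → numCycles-pos (lookup v) (proj₁ (proj₂ h))) (vecs (suc m) (suc m))

  oddPerms-fix0 : ∀ m k → count (λ v → (isPerm? (lookup v) ×-dec oddWithCycles? (suc k) (lookup v)) ×-dec (lookup v F.zero ≟ F.zero)) (vecs (suc m) (suc m)) ≡ oddPerms m k
  oddPerms-fix0 m k = CountFixing0.result m (oddWithCycles? k) (oddWithCycles? (suc k)) OddWithCycles-ext OddWithCycles-ext
    (λ f pf (r , o) → trans (FixedOrbits.cycleCount f F.zero pf) (cong suc r) , FixedParity.odd⇒' f F.zero pf o)
    (λ f pf (r , o) → ℕP.suc-injective (trans (sym (FixedOrbits.cycleCount f F.zero pf)) r) , FixedParity.odd⇐' f F.zero pf o)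

  -- the only permutation of one point fixes it
  oddPerms-1-move0 : ∀ k → count (λ v → (isPerm? (lookup v) ×-dec oddWithCycles? (suc k) (lookup v)) ×-dec ¬? (lookup v F.zero ≟ F.zero)) (vecs 1 1) ≡ 0
  oddPerms-1-move0 k = count-none (λ v → (isPerm? (lookup v) ×-dec oddWithCycles? (suc k) (lookup v)) ×-dec ¬? (lookup v F.zero ≟ F.zero)) h (vecs 1 1)
    where h : ∀ (v : Vec (Fin 1) 1) → ¬ ((IsPerm (lookup v) × OddWithCycles (suc k) (lookup v)) × ¬ (lookup v F.zero ≡ F.zero))
          h (F.zero ∷ []) (_ , ne) = ne refl

  module TwoPointCount (m : ℕ) (k : ℕ) where
    M : ℕ
    M = suc m
    Paft? : (v : Vec (Fin (suc M)) (suc M)) → Dec ((IsPerm (lookup v) × OddWithCycles (suc k) (lookup v)) × lookup v F.zero ≢ F.zero)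
    Paft? v = (isPerm? (lookup v) ×-dec oddWithCycles? (suc k) (lookup v)) ×-dec ¬? (lookup v F.zero ≟ F.zero)
    B : Set
    B = Fin M × (Fin m × Vec (Fin m) m)
    Q3 : B → Set
    Q3 (u , (w , t)) = IsPerm (lookup t) × OddWithCycles (suc k) (lookup t)
    Q3? : (b : B) → Dec (Q3 b)
    Q3? (u , (w , t)) = isPerm? (lookup t) ×-dec oddWithCycles? (suc k) (lookup t)

    comp : (Fin m → Fin m) → Fin M → Fin m → Fin (suc M) → Fin (suc M)
    comp τ u w = insAfter (insAfter τ u w) F.zero (punchIn u w)

    φ : B → Vec (Fin (suc M)) (suc M)
    φ (u , (w , t)) = tabulate (comp (lookup t) u w)

    LB : List B
    LB = cartesianProduct (allFin M) (cartesianProduct (allFin m) (vecs m m))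

    result0 : count Paft? (vecs (suc M) (suc M)) ≡ count Q3? LB
    result0 = transfer Paft? Q3? (vecs _ _) LB (vecs-unique _ _)
        (UP.cartesianProduct⁺ (UP.allFin⁺ M) (UP.cartesianProduct⁺ (UP.allFin⁺ m) (vecs-unique m m))) (vecs-complete _ _)
        (λ { (u , (w , t)) → ∈-cartesianProduct⁺ (∈-allFin u) (∈-cartesianProduct⁺ (∈-allFin w) (vecs-complete m m t)) })
        φ (λ {b} → pres b) (λ {b} {b'} → inj b b') (λ {v} → surj v)
      where
        pres : ∀ b → Q3 b → (IsPerm (lookup (φ b)) × OddWithCycles (suc k) (lookup (φ b))) × ¬ (lookup (φ b) F.zero ≡ F.zero)
        pres (u , (w , t)) (pt , (r , o)) =
            (perm-ext (TwoPointInsertion.A2.pG (lookup t) u w pt) eqL ,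
             OddWithCycles-ext eqL (trans (TwoPointInsertion.cycleCount (lookup t) u w pt) r , TwoPointInsertion.oddD⇒ (lookup t) u w pt o)) ,
            (λ e → pI≢p F.zero _ (trans (sym (aft-p (insAfter (lookup t) u w) F.zero (punchIn u w))) (trans (eqL F.zero) e)))
          where
            eqL : ∀ y → comp (lookup t) u w y ≡ lookup (tabulate (comp (lookup t) u w)) y
            eqL = lt-eq (comp (lookup t) u w)
        -- (u, w, τ) is recovered: first the second insertion point, then u, then τ
        inj : ∀ b b' → Q3 b → Q3 b' → φ b ≡ φ b' → b ≡ b'
        inj (u , (w , t)) (u' , (w' , t')) _ _ e
          with aft-inj {p = F.zero} {f = insAfter (lookup t) u w} {f' = insAfter (lookup t') u' w'} {w = punchIn u w} {w' = punchIn u' w'}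
                 (λ y → trans (lt-eq (comp (lookup t) u w) y) (trans (cong (λ v → lookup v y) e) (sym (lt-eq (comp (lookup t') u' w') y))))
        ... | e1 , h1 with trans (sym (aft-w (lookup t) u w)) (trans (h1 (punchIn u w)) (trans (cong (insAfter (lookup t') u' w') e1) (aft-w (lookup t') u' w')))
        ...   | refl with aft-inj {p = u} {f = lookup t} {f' = lookup t'} {w = w} {w' = w'} h1
        ...     | refl , h2 = cong (λ z → u , (w , z)) (vec-ext h2)
        -- remove 0 and then its image u; 0 cannot lie on a 2-cycle
        surj : ∀ v → (IsPerm (lookup v) × OddWithCycles (suc k) (lookup v)) × ¬ (lookup v F.zero ≡ F.zero) → ∃ λ b → Q3 b × φ b ≡ v
        surj v ((pv , (rv , ov)) , nf) with decomp-aft {p = F.zero} pv nf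
        ... | ρ , w' , pρ , eq1 with ρ (ρ w') ≟ ρ w'
        ...   | yes fixu = ⊥-elim (insAfter-fixed-even ρ F.zero w' pρ (proj₁ pρ (ρ w') w' fixu) (odd-ext eq1 ov))
        ...   | no nfu with decomp-aft {p = ρ w'} pρ nfu
        ...     | τ , w , pτ , eq2 = (ρ w' , (w , tabulate τ)) , (perm-ext pτ (lt-eq τ) , OddWithCycles-ext (lt-eq τ) (rτ , oτ)) , vec-ext fin
          where
            u : Fin M
            u = ρ w'
            w'≡ : w' ≡ punchIn u w
            w'≡ = proj₁ pρ w' (punchIn u w) (sym (trans (eq2 (punchIn u w)) (aft-w τ u w)))
            eq3 : ∀ y → lookup v y ≡ comp τ u w y
            eq3 y = trans (eq1 y) (trans (cong (λ z → insAfter ρ F.zero z y) w'≡) (aft-ext {p = F.zero} {w = punchIn u w} eq2 y))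
            rτ : numCycles τ ≡ suc k
            rτ = trans (sym (TwoPointInsertion.cycleCount τ u w pτ)) (trans (sym (numCycles-ext eq3)) rv)
            oτ : AllCyclesOdd τ
            oτ = TwoPointInsertion.oddD⇐ τ u w pτ (odd-ext eq3 ov)
            fin : ∀ y → lookup (φ (u , (w , tabulate τ))) y ≡ lookup v y
            fin y = trans (sym (lt-eq (comp (lookup (tabulate τ)) u w) y))
                    (trans (aft-ext {p = F.zero} {w = punchIn u w} (aft-ext {p = u} {w = w} (λ x → sym (lt-eq τ x))) y) (sym (eq3 y)))

    result : count Paft? (vecs (suc M) (suc M)) ≡ (M * m) * oddPerms m (suc k)
    result = trans result0 (trans (count-cart Q3? (allFin M) (cartesianProduct (allFin m) (vecs m m)))
      (trans (sumL-const _ (m * oddPerms m (suc k)) inner (allFin M))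
      (trans (cong (_* (m * oddPerms m (suc k))) (length-allFin M)) (sym (ℕP.*-assoc M m (oddPerms m (suc k)))))))
      where
        inner : ∀ u → count (λ y → Q3? (u , y)) (cartesianProduct (allFin m) (vecs m m)) ≡ m * oddPerms m (suc k)
        inner u = trans (count-cart (λ y → Q3? (u , y)) (allFin m) (vecs m m))
                  (trans (sumL-const _ (oddPerms m (suc k)) (λ _ → refl) (allFin m)) (cong (_* oddPerms m (suc k)) (length-allFin m)))

  oddPerms-rec : ∀ m k → oddPerms (suc (suc m)) (suc k) ≡ oddPerms (suc m) k + (suc m * m) * oddPerms m (suc k)
  oddPerms-rec m k = trans (count-split (λ v → isPerm? (lookup v) ×-dec oddWithCycles? (suc k) (lookup v)) (λ v → lookup v F.zero ≟ F.zero) (vecs (suc (suc m)) (suc (suc m))))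
    (cong₂ _+_ (oddPerms-fix0 (suc m) k) (TwoPointCount.result m k))

  oddPerms-1 : ∀ k → oddPerms 1 (suc k) ≡ oddPerms 0 k
  oddPerms-1 k = trans (count-split (λ v → isPerm? (lookup v) ×-dec oddWithCycles? (suc k) (lookup v)) (λ v → lookup v F.zero ≟ F.zero) (vecs 1 1))
    (trans (cong₂ _+_ (oddPerms-fix0 0 k) (oddPerms-1-move0 k)) (ℕP.+-identityʳ _))

-- It is proved for arbitrary sequences c and A satisfying
-- the Stirling recurrence, respectively the odd-cycle recurrence, together with
-- their initial values; Recurrences provides these for the actual counts.
module BinomialConvolution where
  open import Data.Nat as ℕ using (ℕ; zero; suc; _∸_; _≤_; s≤s)
  open import Relation.Binary.PropositionalEquality
  module FromRecurrences (c : ℕ → ℕ → ℕ) (c00 : c 0 0 ≡ 1) (c0s : ∀ i → c 0 (suc i) ≡ 0)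
      (cs0 : ∀ m → c (suc m) 0 ≡ 0) (css : ∀ m i → c (suc m) (suc i) ≡ c m i ℕ.+ m ℕ.* c m (suc i))
      (A : ℕ → ℕ → ℕ) (As0 : ∀ m → A (suc m) 0 ≡ 0) (A11 : A 1 1 ≡ 1) (A1ss : ∀ k → A 1 (suc (suc k)) ≡ 0)
      (Ass : ∀ m k → A (suc (suc m)) (suc k) ≡ A (suc m) k ℕ.+ (suc m ℕ.* m) ℕ.* A m (suc k)) where

    import Data.Nat.Properties as ℕP
    open import Data.Integer using (ℤ; +_; _+_; _*_; -_; _-_)
    open import Data.Integer.Properties
    open import Data.Integer.Tactic.RingSolver
    import Data.Nat.Tactic.RingSolver as NS
    open import Data.Product using (_×_; _,_; proj₁; ∃)
    open import Data.Sum using (_⊎_; inj₁; inj₂)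
    open Binomial
    open FiniteSums
    open import Defs using (sign)

    r : ℕ → ℕ → ℤ
    r a i = + c (suc a) i

    s : ℕ → ℕ → ℤ
    s b j = sign (suc b ℕ.+ j) * + c (suc b) j

    r-rec : ∀ a i → r (suc a) i ≡ sh (r a) i + + suc a * r a i
    r-rec a zero = trans (cong +_ (cs0 (suc a))) (sym (trans (+-identityˡ _) (trans (cong (λ z → + suc a * + z) (cs0 a)) (*-zeroʳ (+ suc a)))))
    r-rec a (suc i) = trans (cong +_ (css (suc a) i)) (trans (pos-+ (c (suc a) i) (suc a ℕ.* c (suc a) (suc i))) (cong (_+_ (+ c (suc a) i)) (pos-* (suc a) (c (suc a) (suc i)))))

    sign2 : ∀ e → sign (suc (suc e)) ≡ sign e
    sign2 e = negate-twice (sign e)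
      where negate-twice : ∀ x → (- (+ 1)) * ((- (+ 1)) * x) ≡ x
            negate-twice = solve-∀

    s-rec : ∀ b j → s (suc b) j ≡ sh (s b) j + (- (+ suc b)) * s b j
    s-rec b zero = trans l1 (sym (trans (+-identityˡ _) r1))
      where
        l1 : sign (suc (suc b) ℕ.+ 0) * + c (suc (suc b)) 0 ≡ + 0
        l1 = trans (cong (λ z → sign (suc (suc b) ℕ.+ 0) * + z) (cs0 (suc b))) (*-zeroʳ (sign (suc (suc b) ℕ.+ 0)))
        r1 : (- (+ suc b)) * (sign (suc b ℕ.+ 0) * + c (suc b) 0) ≡ + 0
        r1 = trans (cong (λ z → (- (+ suc b)) * (sign (suc b ℕ.+ 0) * + z)) (cs0 b))
             (trans (cong ((- (+ suc b)) *_) (*-zeroʳ (sign (suc b ℕ.+ 0)))) (*-zeroʳ (- (+ suc b))))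
    s-rec b (suc j) = begin
        sign (suc (suc b) ℕ.+ suc j) * + c (suc (suc b)) (suc j)
      ≡⟨ cong₂ _*_ (trans (sign2 (b ℕ.+ suc j)) (cong sign (ℕP.+-suc b j))) (trans (cong +_ (css (suc b) j)) (trans (pos-+ (c (suc b) j) (suc b ℕ.* c (suc b) (suc j))) (cong (_+_ (+ c (suc b) j)) (pos-* (suc b) (c (suc b) (suc j)))))) ⟩
        σ * (+ c (suc b) j + + suc b * + c (suc b) (suc j))
      ≡⟨ sign-step σ (+ c (suc b) j) (+ suc b) (+ c (suc b) (suc j)) ⟩
        σ * + c (suc b) j + (- (+ suc b)) * (((- (+ 1)) * σ) * + c (suc b) (suc j))
      ≡⟨ cong (λ z → σ * + c (suc b) j + (- (+ suc b)) * (z * + c (suc b) (suc j))) (cong ((- (+ 1)) *_) (cong sign (sym (ℕP.+-suc b j)))) ⟩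
        sh (s b) (suc j) + (- (+ suc b)) * s b (suc j)
      ∎ where
        open ≡-Reasoning
        σ : ℤ
        σ = sign (suc (b ℕ.+ j))
        sign-step : ∀ σ x B y → σ * (x + B * y) ≡ σ * x + (- B) * (((- (+ 1)) * σ) * y)
        sign-step = solve-∀

    T : ℕ → ℕ → ℕ → ℤ
    T a b d = conv (r a) (s b) d

    T-sa : ∀ a b d → T (suc a) b d ≡ sh (T a b) d + + suc a * T a b d
    T-sa a b d = trans (conv-congˡ (s b) d (r-rec a))
      (trans (conv-+ˡ (sh (r a)) (λ i → + suc a * r a i) (s b) d)
      (cong₂ _+_ (conv-shˡ (r a) (s b) d) (conv-*ˡ (+ suc a) (r a) (s b) d)))

    T-sb : ∀ a b d → T a (suc b) d ≡ sh (T a b) d + (- (+ suc b)) * T a b d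
    T-sb a b d = trans (conv-congʳ (r a) d (s-rec b))
      (trans (conv-+ʳ (r a) (sh (s b)) (λ i → (- (+ suc b)) * s b i) d)
      (cong₂ _+_ (conv-shʳ (r a) (s b) d) (conv-*ʳ (- (+ suc b)) (r a) (s b) d)))

    F : ℕ → ℕ → ℤ
    F n d = B n (λ a b → T a b d)

    E : ℕ → ℕ → ℤ
    E n d = B n (λ a b → (+ a - + b) * T a b d)

    shB : ∀ n d → B n (λ a b → sh (T a b) d) ≡ sh (F n) d
    shB n zero = Σ-0 (suc n) (λ k → + bin n k * + 0) (λ i _ → *-zeroʳ (+ bin n i))
    shB n (suc d) = refl

    -- Pascal's rule and the shift recurrences: F(n+1,d) = 2 F(n,d-1) + E(n,d)
    F-rec : ∀ n d → F (suc n) d ≡ + 2 * sh (F n) d + E n d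
    F-rec n d = begin
        F (suc n) d
      ≡⟨ B-pascal n (λ a b → T a b d) ⟩
        B n (λ a b → T (suc a) b d + T a (suc b) d)
      ≡⟨ B-cong n {λ a b → T (suc a) b d + T a (suc b) d} {λ a b → + 2 * sh (T a b) d + (+ a - + b) * T a b d} (λ k _ → trans (cong₂ _+_ (T-sa (n ∸ k) k d) (T-sb (n ∸ k) k d)) (combine (sh (T (n ∸ k) k) d) (T (n ∸ k) k d) (+ (n ∸ k)) (+ k))) ⟩
        B n (λ a b → + 2 * sh (T a b) d + (+ a - + b) * T a b d)
      ≡⟨ B-+ n (λ a b → + 2 * sh (T a b) d) (λ a b → (+ a - + b) * T a b d) ⟩
        B n (λ a b → + 2 * sh (T a b) d) + E n d
      ≡⟨ cong (_+ E n d) (trans (B-* n (+ 2) (λ a b → sh (T a b) d)) (cong (+ 2 *_) (shB n d))) ⟩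
        + 2 * sh (F n) d + E n d
      ∎ where
        open ≡-Reasoning
        combine : ∀ S t a b → (S + (+ 1 + a) * t) + (S + (- (+ 1 + b)) * t) ≡ + 2 * S + (a - b) * t
        combine = solve-∀

    E0 : ∀ d → E 0 d ≡ + 0
    E0 d = trans (+-identityʳ _) (trans (*-identityˡ _) (*-zeroˡ (T 0 0 d)))

    pos∸ : ∀ M k → k ≤ M → + (M ∸ k) + + k ≡ + M
    pos∸ M k le = trans (sym (pos-+ (M ∸ k) k)) (cong +_ (ℕP.m∸n+n≡m le))

    -- absorption and the shift recurrences: E(m+1,d) = (m+1)(m+2) F(m,d)
    E-suc : ∀ m d → E (suc m) d ≡ + (suc m ℕ.* suc (suc m)) * F m d
    E-suc m d = begin
        E (suc m) d
      ≡⟨ B-cong (suc m) {λ a b → (+ a - + b) * T a b d} {λ a b → + suc m * T a b d + (- (+ 2)) * (+ b * T a b d)}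
           (λ k le → trans (split-weight (+ (suc m ∸ k)) (+ k) (T (suc m ∸ k) k d)) (cong (λ z → z * T (suc m ∸ k) k d + (- (+ 2)) * (+ k * T (suc m ∸ k) k d)) (pos∸ (suc m) k le))) ⟩
        B (suc m) (λ a b → + suc m * T a b d + (- (+ 2)) * (+ b * T a b d))
      ≡⟨ B-+ (suc m) (λ a b → + suc m * T a b d) (λ a b → (- (+ 2)) * (+ b * T a b d)) ⟩
        B (suc m) (λ a b → + suc m * T a b d) + B (suc m) (λ a b → (- (+ 2)) * (+ b * T a b d))
      ≡⟨ cong₂ _+_ (B-* (suc m) (+ suc m) (λ a b → T a b d))
           (trans (B-* (suc m) (- (+ 2)) (λ a b → + b * T a b d)) (cong ((- (+ 2)) *_) (B-absorb m (λ a b → T a b d)))) ⟩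
        + suc m * F (suc m) d + (- (+ 2)) * (+ suc m * Y)
      ≡⟨ cong (λ z → + suc m * z + (- (+ 2)) * (+ suc m * Y)) (trans (B-pascal m (λ a b → T a b d)) (B-+ m (λ a b → T (suc a) b d) (λ a b → T a (suc b) d))) ⟩
        + suc m * (X + Y) + (- (+ 2)) * (+ suc m * Y)
      ≡⟨ collect (+ suc m) X Y ⟩
        + suc m * (X + (- (+ 1)) * Y)
      ≡⟨ cong (+ suc m *_) (sym (trans (B-+ m (λ a b → T (suc a) b d) (λ a b → (- (+ 1)) * T a (suc b) d)) (cong (_+_ X) (B-* m (- (+ 1)) (λ a b → T a (suc b) d))))) ⟩
        + suc m * B m (λ a b → T (suc a) b d + (- (+ 1)) * T a (suc b) d)
      ≡⟨ cong (+ suc m *_) (B-cong m {λ a b → T (suc a) b d + (- (+ 1)) * T a (suc b) d} {λ a b → + suc (suc m) * T a b d}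
           (λ k le → trans (cong₂ (λ u v → u + (- (+ 1)) * v) (T-sa (m ∸ k) k d) (T-sb (m ∸ k) k d))
                     (trans (shift-difference (sh (T (m ∸ k) k) d) (T (m ∸ k) k d) (+ (m ∸ k)) (+ k))
                            (cong (λ z → (+ 2 + z) * T (m ∸ k) k d) (pos∸ m k le))))) ⟩
        + suc m * B m (λ a b → + suc (suc m) * T a b d)
      ≡⟨ cong (+ suc m *_) (B-* m (+ suc (suc m)) (λ a b → T a b d)) ⟩
        + suc m * (+ suc (suc m) * F m d)
      ≡⟨ sym (trans (cong (_* F m d) (pos-* (suc m) (suc (suc m)))) (*-assoc (+ suc m) (+ suc (suc m)) (F m d))) ⟩
        + (suc m ℕ.* suc (suc m)) * F m d
      ∎ where
        open ≡-Reasoning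
        X : ℤ
        X = B m (λ a b → T (suc a) b d)
        Y : ℤ
        Y = B m (λ a b → T a (suc b) d)
        split-weight : ∀ a b t → (a - b) * t ≡ (a + b) * t + (- (+ 2)) * (b * t)
        split-weight = solve-∀
        collect : ∀ M x y → M * (x + y) + (- (+ 2)) * (M * y) ≡ M * (x + (- (+ 1)) * y)
        collect = solve-∀
        shift-difference : ∀ S t a b → (S + (+ 1 + a) * t) + (- (+ 1)) * (S + (- (+ 1 + b)) * t) ≡ (+ 2 + (a + b)) * t
        shift-difference = solve-∀

    -- base case: T(0,0,d) = [d = 2], because c(1,i) = [i = 1]
    c10 : c 1 0 ≡ 0
    c10 = cs0 0
    c11 : c 1 1 ≡ 1
    c11 = trans (css 0 0) (cong (ℕ._+ 0) c00)
    c1ss : ∀ i → c 1 (suc (suc i)) ≡ 0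
    c1ss i = trans (css 0 (suc i)) (trans (ℕP.+-identityʳ _) (c0s i))

    r0-0 : r 0 0 ≡ + 0
    r0-0 = cong +_ c10
    r0-ss : ∀ i → r 0 (suc (suc i)) ≡ + 0
    r0-ss i = cong +_ (c1ss i)
    s0-0 : ∀ e → sign e * + c 1 0 ≡ + 0
    s0-0 e = trans (cong (λ z → sign e * + z) c10) (*-zeroʳ (sign e))
    s0-ss : ∀ e i → sign e * + c 1 (suc (suc i)) ≡ + 0
    s0-ss e i = trans (cong (λ z → sign e * + z) (c1ss i)) (*-zeroʳ (sign e))

    term0 : ∀ i j → (i ≡ 1 → (j ≡ 0) ⊎ (∃ λ j' → j ≡ suc (suc j'))) → r 0 i * s 0 j ≡ + 0
    term0 zero j _ = trans (cong (_* s 0 j) r0-0) (*-zeroˡ (s 0 j))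
    term0 (suc (suc i)) j _ = trans (cong (_* s 0 j) (r0-ss i)) (*-zeroˡ (s 0 j))
    term0 (suc zero) j h with h refl
    ... | inj₁ refl = trans (cong (r 0 1 *_) (s0-0 (suc 0 ℕ.+ 0))) (*-zeroʳ (r 0 1))
    ... | inj₂ (j' , refl) = trans (cong (r 0 1 *_) (s0-ss (suc (suc (suc j'))) j')) (*-zeroʳ (r 0 1))

    T00-1 : T 0 0 1 ≡ + 0
    T00-1 = Σ-0 2 (λ i → r 0 i * s 0 (1 ∸ i)) λ { zero _ → term0 0 1 (λ ()) ; (suc zero) _ → term0 1 0 (λ _ → inj₁ refl) ; (suc (suc i)) (s≤s (s≤s ())) }

    T00-0 : T 0 0 0 ≡ + 0
    T00-0 = Σ-0 1 (λ i → r 0 i * s 0 (0 ∸ i)) λ { zero _ → term0 0 0 (λ ()) ; (suc i) (s≤s ()) }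

    T00-3 : ∀ e → T 0 0 (suc (suc (suc e))) ≡ + 0
    T00-3 e = Σ-0 (suc (suc (suc (suc e)))) (λ i → r 0 i * s 0 (suc (suc (suc e)) ∸ i))
      λ { zero _ → term0 0 (suc (suc (suc e))) (λ ()) ; (suc zero) _ → term0 1 (suc (suc e)) (λ _ → inj₂ (e , refl)) ; (suc (suc i)) _ → term0 (suc (suc i)) (suc (suc (suc e)) ∸ suc (suc i)) (λ ()) }

    T00-2 : T 0 0 2 ≡ + 1
    T00-2 = trans (cong₂ _+_ (term0 0 2 (λ ())) (cong₂ _+_ r11 (trans (cong₂ _+_ (term0 2 0 (λ ())) refl) (+-identityʳ (+ 0))))) refl
      where
        r11 : r 0 1 * s 0 1 ≡ + 1
        r11 = trans (cong₂ (λ u v → + u * (sign 2 * + v)) c11 c11) refl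

    closed : ℕ → ℕ → ℕ
    closed n zero = 0
    closed n (suc zero) = 0
    closed n (suc (suc e)) = 2 ℕ.^ e ℕ.* A (suc n) (suc e)

    F0 : ∀ d → F 0 d ≡ + closed 0 d
    F0 d = trans (trans (+-identityʳ _) (*-identityˡ (T 0 0 d))) (h d)
      where
        h : ∀ d → T 0 0 d ≡ + closed 0 d
        h zero = T00-0
        h (suc zero) = T00-1
        h (suc (suc zero)) = trans T00-2 (cong +_ (sym (trans (ℕP.+-identityʳ _) A11)))
        h (suc (suc (suc e))) = trans (T00-3 e) (cong +_ (sym (trans (cong (2 ℕ.^ suc e ℕ.*_) (A1ss e)) (ℕP.*-zeroʳ (2 ℕ.^ suc e)))))

    shN : (ℕ → ℕ) → ℕ → ℕ
    shN f zero = 0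
    shN f (suc d) = f d

    sh-pos : ∀ (f : ℕ → ℕ) d → sh (λ e → + f e) d ≡ + shN f d
    sh-pos f zero = refl
    sh-pos f (suc d) = refl

    closed-1 : ∀ d → closed 1 d ≡ 2 ℕ.* shN (closed 0) d
    closed-1 zero = refl
    closed-1 (suc zero) = refl
    closed-1 (suc (suc zero)) = cong (ℕ._+ 0) (trans (Ass 0 0) (trans (ℕP.+-identityʳ _) (As0 0)))
    closed-1 (suc (suc (suc e))) = trans (cong (2 ℕ.^ suc e ℕ.*_) (trans (Ass 0 (suc e)) (ℕP.+-identityʳ _))) (ℕP.*-assoc 2 (2 ℕ.^ e) (A 1 (suc e)))

    closed-rec : ∀ m d → closed (suc (suc m)) d ≡ 2 ℕ.* shN (closed (suc m)) d ℕ.+ (suc m ℕ.* suc (suc m)) ℕ.* closed m d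
    closed-rec m zero = sym (ℕP.*-zeroʳ (suc m ℕ.* suc (suc m)))
    closed-rec m (suc zero) = sym (ℕP.*-zeroʳ (suc m ℕ.* suc (suc m)))
    closed-rec m (suc (suc zero)) = trans (cong (ℕ._+ 0) (Ass (suc m) 0))
      (trans (cong (λ z → z ℕ.+ (suc (suc m) ℕ.* suc m) ℕ.* A (suc m) 1 ℕ.+ 0) (As0 (suc m))) (arrange m (A (suc m) 1)))
      where arrange : ∀ m x → 0 ℕ.+ (suc (suc m) ℕ.* suc m) ℕ.* x ℕ.+ 0 ≡ 2 ℕ.* 0 ℕ.+ (suc m ℕ.* suc (suc m)) ℕ.* (1 ℕ.* x)
            arrange = NS.solve-∀
    closed-rec m (suc (suc (suc e))) = trans (cong (2 ℕ.^ suc e ℕ.*_) (Ass (suc m) (suc e))) (arrange (2 ℕ.^ e) (A (suc (suc m)) (suc e)) m (A (suc m) (suc (suc e))))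
      where arrange : ∀ p x m y → (2 ℕ.* p) ℕ.* (x ℕ.+ (suc (suc m) ℕ.* suc m) ℕ.* y) ≡ 2 ℕ.* (p ℕ.* x) ℕ.+ (suc m ℕ.* suc (suc m)) ℕ.* ((2 ℕ.* p) ℕ.* y)
            arrange = NS.solve-∀

    F≡closed-pair : ∀ n → (∀ d → F n d ≡ + closed n d) × (∀ d → F (suc n) d ≡ + closed (suc n) d)
    F≡closed-pair zero = F0 , F1
      where
        F1 : ∀ d → F 1 d ≡ + closed 1 d
        F1 d = begin
            F 1 d
          ≡⟨ F-rec 0 d ⟩
            + 2 * sh (F 0) d + E 0 d
          ≡⟨ cong₂ _+_ (cong (+ 2 *_) (trans (shcong d) (sh-pos (closed 0) d))) (E0 d) ⟩
            + 2 * + shN (closed 0) d + + 0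
          ≡⟨ trans (+-identityʳ _) (sym (pos-* 2 (shN (closed 0) d))) ⟩
            + (2 ℕ.* shN (closed 0) d)
          ≡⟨ cong +_ (sym (closed-1 d)) ⟩
            + closed 1 d
          ∎ where
            open ≡-Reasoning
            shcong : ∀ d → sh (F 0) d ≡ sh (λ e → + closed 0 e) d
            shcong zero = refl
            shcong (suc d) = F0 d
    F≡closed-pair (suc n) with F≡closed-pair n
    ... | ih0 , ih1 = ih1 , F2
      where
        F2 : ∀ d → F (suc (suc n)) d ≡ + closed (suc (suc n)) d
        F2 d = begin
            F (suc (suc n)) d
          ≡⟨ F-rec (suc n) d ⟩
            + 2 * sh (F (suc n)) d + E (suc n) d
          ≡⟨ cong₂ _+_ (cong (+ 2 *_) (trans (shcong d) (sh-pos (closed (suc n)) d))) (trans (E-suc n d) (cong (+ (suc n ℕ.* suc (suc n)) *_) (ih0 d))) ⟩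
            + 2 * + shN (closed (suc n)) d + + (suc n ℕ.* suc (suc n)) * + closed n d
          ≡⟨ cong₂ _+_ (sym (pos-* 2 (shN (closed (suc n)) d))) (sym (pos-* (suc n ℕ.* suc (suc n)) (closed n d))) ⟩
            + (2 ℕ.* shN (closed (suc n)) d) + + ((suc n ℕ.* suc (suc n)) ℕ.* closed n d)
          ≡⟨ sym (pos-+ (2 ℕ.* shN (closed (suc n)) d) _) ⟩
            + (2 ℕ.* shN (closed (suc n)) d ℕ.+ (suc n ℕ.* suc (suc n)) ℕ.* closed n d)
          ≡⟨ cong +_ (sym (closed-rec n d)) ⟩
            + closed (suc (suc n)) d
          ∎ where
            open ≡-Reasoning
            shcong : ∀ d → sh (F (suc n)) d ≡ sh (λ e → + closed (suc n) e) d
            shcong zero = refl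
            shcong (suc d) = ih1 d

    F≡closed : ∀ n d → F n d ≡ + closed n d
    F≡closed n = proj₁ (F≡closed-pair n)

module ListSums where
  open import Data.Nat using (ℕ; zero; suc; _<_; z≤n; s≤s)
  import Data.Nat.Properties as ℕP
  open import Data.Integer using (ℤ; +_; _+_)
  open import Data.Integer.Properties using (+-identityˡ; +-identityʳ; +-assoc)
  open import Data.List using (List; []; _∷_; map; filter; cartesianProduct; upTo; applyUpTo; _++_)
  open import Data.List.Properties using (map-++)
  open import Data.Product using (_×_; _,_)
  open import Relation.Binary.PropositionalEquality
  open import Relation.Nullary
  open import Relation.Unary using (Decidable)
  open import Data.Empty
  open import Function using (_∘_)
  open import Defs using (sumℤ)
  open FiniteSums using (Σ; Σ-cong; Σ-0)

  ite : ∀ {X : Set} → Dec X → ℤ → ℤ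
  ite (yes _) x = x
  ite (no _) x = + 0

  ite-ext : ∀ {X Y : Set} (d : Dec X) (e : Dec Y) → (X → Y) → (Y → X) → ∀ x → ite d x ≡ ite e x
  ite-ext (yes _) (yes _) _ _ x = refl
  ite-ext (yes a) (no nb) f _ x = ⊥-elim (nb (f a))
  ite-ext (no na) (yes b) _ g x = ⊥-elim (na (g b))
  ite-ext (no _) (no _) _ _ x = refl

  ite-no : ∀ {X : Set} (d : Dec X) → ¬ X → ∀ x → ite d x ≡ + 0
  ite-no (yes a) n x = ⊥-elim (n a)
  ite-no (no _) n x = refl

  ite-yes : ∀ {X : Set} (d : Dec X) → X → ∀ x → ite d x ≡ x
  ite-yes (yes _) _ x = refl
  ite-yes (no n) a x = ⊥-elim (n a)

  sumIte : ∀ {A : Set} {P : A → Set} (P? : Decidable P) (f : A → ℤ) L → sumℤ (map f (filter P? L)) ≡ sumℤ (map (λ a → ite (P? a) (f a)) L)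
  sumIte P? f [] = refl
  sumIte P? f (x ∷ L) with P? x
  ... | yes _ = cong (_+_ (f x)) (sumIte P? f L)
  ... | no _ = trans (sumIte P? f L) (sym (+-identityˡ _))

  sum-++ : ∀ xs ys → sumℤ (xs ++ ys) ≡ sumℤ xs + sumℤ ys
  sum-++ [] ys = sym (+-identityˡ _)
  sum-++ (x ∷ xs) ys = trans (cong (_+_ x) (sum-++ xs ys)) (sym (+-assoc x (sumℤ xs) (sumℤ ys)))

  sum-cart : ∀ {A B : Set} (F : A × B → ℤ) xs ys → sumℤ (map F (cartesianProduct xs ys)) ≡ sumℤ (map (λ x → sumℤ (map (λ y → F (x , y)) ys)) xs)
  sum-cart F [] ys = refl
  sum-cart F (x ∷ xs) ys = trans (cong sumℤ (map-++ F (map (x ,_) ys) (cartesianProduct xs ys)))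
    (trans (sum-++ (map F (map (x ,_) ys)) (map F (cartesianProduct xs ys)))
    (cong₂ _+_ (cong sumℤ (sym (Data.List.Properties.map-∘ ys))) (sum-cart F xs ys)))

  sum-applyUpTo : ∀ (f : ℕ → ℤ) h n → sumℤ (map f (applyUpTo h n)) ≡ Σ n (f ∘ h)
  sum-applyUpTo f h zero = refl
  sum-applyUpTo f h (suc n) = cong (_+_ (f (h 0))) (sum-applyUpTo f (h ∘ suc) n)

  sum-upTo : ∀ (f : ℕ → ℤ) n → sumℤ (map f (upTo n)) ≡ Σ n f
  sum-upTo f n = sum-applyUpTo f (λ i → i) n

  Σ-δ : ∀ M {Q : ℕ → Set} (Q? : Decidable Q) (h : ℕ → ℤ) j0 → (∀ j → Q j → j ≡ j0) → Q j0 → j0 < M → Σ M (λ j → ite (Q? j) (h j)) ≡ h j0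
  Σ-δ (suc M) Q? h zero uq q0 lt = trans (cong₂ _+_ (ite-yes (Q? 0) q0 (h 0)) (Σ-0 M _ (λ i _ → ite-no (Q? (suc i)) (λ q → ℕP.0≢1+n (sym (uq (suc i) q))) (h (suc i))))) (+-identityʳ (h 0))
  Σ-δ (suc M) Q? h (suc j0) uq q0 (s≤s lt) = trans (cong₂ _+_ (ite-no (Q? 0) (λ q → ℕP.0≢1+n (uq 0 q)) (h 0)) (Σ-δ M (λ j → Q? (suc j)) (h ∘ suc) j0 (λ j q → ℕP.suc-injective (uq (suc j) q)) q0 lt)) (+-identityˡ _)

  Σ-none : ∀ M {Q : ℕ → Set} (Q? : Decidable Q) (h : ℕ → ℤ) → (∀ j → ¬ Q j) → Σ M (λ j → ite (Q? j) (h j)) ≡ + 0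
  Σ-none M Q? h nq = Σ-0 M _ (λ j _ → ite-no (Q? j) (nq j) (h j))

  Σ-trunc : ∀ M d (h : ℕ → ℤ) → d < M → Σ M (λ i → ite (i ℕP.≤? d) (h i)) ≡ Σ (suc d) h
  Σ-trunc (suc M) zero h _ = cong₂ _+_ (ite-yes (0 ℕP.≤? 0) z≤n (h 0)) (Σ-0 M _ (λ i _ → ite-no (suc i ℕP.≤? 0) (λ ()) (h (suc i))))
  Σ-trunc (suc M) (suc d) h (s≤s lt) = cong₂ _+_ (ite-yes (0 ℕP.≤? suc d) z≤n (h 0))
    (trans (Σ-cong M (λ i _ → ite-ext (suc i ℕP.≤? suc d) (i ℕP.≤? d) ℕP.≤-pred s≤s (h (suc i)))) (Σ-trunc M d (h ∘ suc) lt))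

module PairSums where
  open import Data.Nat using (ℕ; suc; _+_; _∸_; _≤_; _<_)
  import Data.Nat.Properties as ℕP
  open import Data.Integer using (ℤ; +_)
  open import Data.List using (map; filter; cartesianProduct; upTo)
  open import Data.Product using (_×_; _,_)
  open import Relation.Binary.PropositionalEquality
  open import Relation.Nullary
  open import Relation.Unary using (Decidable)
  open import Defs using (sumℤ)
  open FiniteSums using (Σ; Σ-cong; Σ-0)
  open ListSums

  filtered-as-Σ : ∀ {P : ℕ × ℕ → Set} (P? : Decidable P) (f : ℕ × ℕ → ℤ) (M : ℕ) (t : ℕ → ℕ → ℤ) →
    (∀ i j → f (i , j) ≡ t i j) →
    sumℤ (map f (filter P? (cartesianProduct (upTo M) (upTo M)))) ≡ Σ M (λ i → Σ M (λ j → ite (P? (i , j)) (t i j)))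
  filtered-as-Σ P? f M t hf = trans (sumIte P? f (cartesianProduct (upTo M) (upTo M))) (trans (sum-cart (λ a → ite (P? a) (f a)) (upTo M) (upTo M))
    (trans (sum-upTo _ M) (Σ-cong M (λ i _ → trans (sum-upTo _ M) (Σ-cong M (λ j _ → cong (ite (P? (i , j))) (hf i j)))))))

  module Eval {P : ℕ × ℕ → Set} (P? : Decidable P) (M N D : ℕ) (t : ℕ → ℕ → ℤ)
    (h1 : ∀ i j → P (i , j) → i + j + D ≡ N) (h2 : ∀ i j → i + j + D ≡ N → P (i , j)) (lt : N < M) where

    Σ-constrained : D ≤ N → Σ M (λ i → Σ M (λ j → ite (P? (i , j)) (t i j))) ≡ Σ (suc (N ∸ D)) (λ i → t i ((N ∸ D) ∸ i))
    Σ-constrained D≤N = trans (Σ-cong M (λ i _ → pt i)) (Σ-trunc M d (λ i → t i (d ∸ i)) (ℕP.≤-<-trans (ℕP.m∸n≤m N D) lt))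
      where
        d : ℕ
        d = N ∸ D
        ij : ∀ i j → i + j + D ≡ N → i + j ≡ d
        ij i j e = trans (sym (ℕP.m+n∸n≡m (i + j) D)) (cong (_∸ D) e)
        pt : ∀ i → Σ M (λ j → ite (P? (i , j)) (t i j)) ≡ ite (i ℕP.≤? d) (t i (d ∸ i))
        pt i with i ℕP.≤? d
        ... | yes i≤d = Σ-δ M (λ j → P? (i , j)) (t i) (d ∸ i)
              (λ j q → trans (sym (ℕP.m+n∸m≡n i j)) (cong (_∸ i) (ij i j (h1 i j q))))
              (h2 i (d ∸ i) (trans (cong (_+ D) (ℕP.m+[n∸m]≡n i≤d)) (ℕP.m∸n+n≡m D≤N)))
              (ℕP.≤-<-trans (ℕP.m∸n≤m d i) (ℕP.≤-<-trans (ℕP.m∸n≤m N D) lt))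
        ... | no i≰d = Σ-none M (λ j → P? (i , j)) (t i) (λ j q → i≰d (ℕP.≤-trans (ℕP.m≤m+n i j) (ℕP.≤-reflexive (ij i j (h1 i j q)))))

    Σ-constrained-empty : N < D → Σ M (λ i → Σ M (λ j → ite (P? (i , j)) (t i j))) ≡ + 0
    Σ-constrained-empty N<D = Σ-0 M _ (λ i _ → Σ-none M (λ j → P? (i , j)) (t i)
        (λ j q → ℕP.<⇒≱ N<D (ℕP.≤-trans (ℕP.m≤n+m D (i + j)) (ℕP.≤-reflexive (h1 i j q)))))

module Assembly where
  open import Data.Nat using (ℕ; zero; suc; _+_; _*_; _∸_; _≤_; _<_; s≤s; _^_)
  import Data.Nat.Properties as ℕP
  open import Data.Integer as ℤ using (ℤ; +_)
  import Data.Integer.Properties as ℤP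
  open import Data.Vec using (lookup)
  open import Data.Product using (_,_; proj₁; proj₂)
  open import Relation.Binary.PropositionalEquality
  open import Relation.Nullary
  open import Relation.Nullary.Decidable using (_×-dec_)
  open import Data.Empty
  open import Data.Nat.Combinatorics using (_C_)
  open import Defs
  open Counting
  open Binomial
  open FiniteSums
  open ListSums
  open PairSums
  open Enumeration
  open Recurrences

  cs0 : ∀ m → c (suc m) 0 ≡ 0
  cs0 m = trans (c≡cyc (suc m) 0) (cyc-s0 m)

  css : ∀ m i → c (suc m) (suc i) ≡ c m i + m * c m (suc i)
  css m i = trans (c≡cyc (suc m) (suc i)) (trans (cyc-rec m i) (sym (cong₂ (λ a b → a + m * b) (c≡cyc m i) (c≡cyc m (suc i)))))

  A11 : oddPerms 1 1 ≡ 1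
  A11 = oddPerms-1 0

  A1ss : ∀ k → oddPerms 1 (suc (suc k)) ≡ 0
  A1ss k = oddPerms-1 (suc k)

  module AG = BinomialConvolution.FromRecurrences c refl (λ i → refl) cs0 css oddPerms oddPerms-s0 A11 A1ss oddPerms-rec

  summand : ∀ n k → ℕ → ℕ → ℤ
  summand n k i j = AG.r (n ∸ k) i ℤ.* AG.s k j

  inner-gen : ∀ n g k → innerSum n g k ≡ Σ (n + 3) (λ i → Σ (n + 3) (λ j → ite ((i + j + 2 * g) ℕP.≟ (n + 2)) (summand n k i j)))
  inner-gen n g k = filtered-as-Σ _ _ (n + 3) (summand n k) hf
    where
      hf : ∀ i j → (+ c (n ∸ k + 1) i) ℤ.* sign (k + 1 + j) ℤ.* (+ c (k + 1) j) ≡ summand n k i j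
      hf i j = trans (cong₂ (λ a b → (+ c a i) ℤ.* sign (b + j) ℤ.* (+ c b j)) (ℕP.+-comm (n ∸ k) 1) (ℕP.+-comm k 1))
                     (ℤP.*-assoc (+ c (suc (n ∸ k)) i) (sign (suc k + j)) (+ c (suc k) j))

  inner-T : ∀ n g k → 2 * g ≤ n + 2 → innerSum n g k ≡ AG.T (n ∸ k) k (n + 2 ∸ 2 * g)
  inner-T n g k le = trans (inner-gen n g k) (Eval.Σ-constrained (λ p → (proj₁ p + proj₂ p + 2 * g) ℕP.≟ (n + 2)) (n + 3) (n + 2) (2 * g) (summand n k) (λ i j e → e) (λ i j e → e) (ℕP.+-monoʳ-< n (ℕP.n<1+n 2)) le)

  inner-0 : ∀ n g k → n + 2 < 2 * g → innerSum n g k ≡ + 0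
  inner-0 n g k lt = trans (inner-gen n g k) (Eval.Σ-constrained-empty (λ p → (proj₁ p + proj₂ p + 2 * g) ℕP.≟ (n + 2)) (n + 3) (n + 2) (2 * g) (summand n k) (λ i j e → e) (λ i j e → e) (ℕP.+-monoʳ-< n (ℕP.n<1+n 2)) lt)

  LHS-F : ∀ n g → 2 * g ≤ n + 2 → LHS n g ≡ AG.F n (n + 2 ∸ 2 * g)
  LHS-F n g le = trans (sum-upTo (λ k → (+ (n C k)) ℤ.* innerSum n g k) (suc n))
    (Σ-cong (suc n) (λ k _ → cong₂ ℤ._*_ (cong +_ (sym (bin≡C n k))) (inner-T n g k le)))

  LHS-0 : ∀ n g → n + 2 < 2 * g → LHS n g ≡ + 0
  LHS-0 n g lt = trans (sum-upTo (λ k → (+ (n C k)) ℤ.* innerSum n g k) (suc n))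
    (Σ-0 (suc n) _ (λ k _ → trans (cong ((+ (n C k)) ℤ.*_) (inner-0 n g k lt)) (ℤP.*-zeroʳ (+ (n C k)))))

  O-cnt : ∀ m g → O m g ≡ count (λ v → isPerm? (lookup v) ×-dec ((numCycles (lookup v) + 2 * g ℕP.≟ m) ×-dec allCyclesOdd? (lookup v))) (vecs m m)
  O-cnt m g = count-ff (λ v → isPerm? (lookup v)) (λ v → (numCycles (lookup v) + 2 * g ℕP.≟ m) ×-dec allCyclesOdd? (lookup v)) (vecs m m)

  O-A : ∀ n g → 2 * g ≤ n → O (suc n) g ≡ oddPerms (suc n) (suc (n ∸ 2 * g))
  O-A n g le = trans (O-cnt (suc n) g) (count-ext _ _ (λ v h → proj₁ h , to (proj₁ (proj₂ h)) , proj₂ (proj₂ h)) (λ v h → proj₁ h , fro (proj₁ (proj₂ h)) , proj₂ (proj₂ h)) (vecs (suc n) (suc n)))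
    where
      e1 : suc (n ∸ 2 * g) + 2 * g ≡ suc n
      e1 = cong suc (ℕP.m∸n+n≡m le)
      to : ∀ {x} → x + 2 * g ≡ suc n → x ≡ suc (n ∸ 2 * g)
      to {x} e = ℕP.+-cancelʳ-≡ (2 * g) x (suc (n ∸ 2 * g)) (trans e (sym e1))
      fro : ∀ {x} → x ≡ suc (n ∸ 2 * g) → x + 2 * g ≡ suc n
      fro refl = e1

  O-0 : ∀ n g → n < 2 * g → O (suc n) g ≡ 0
  O-0 n g lt = trans (O-cnt (suc n) g) (count-none _ (λ v h → numCycles-pos (lookup v) (zer (proj₁ (proj₂ h)))) (vecs (suc n) (suc n)))
    where
      zer : ∀ {x} → x + 2 * g ≡ suc n → x ≡ 0
      zer {zero} e = refl
      zer {suc x} e = ⊥-elim (ℕP.<⇒≱ lt (ℕP.≤-trans (ℕP.m≤n+m (2 * g) x) (ℕP.≤-reflexive (ℕP.suc-injective e))))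

  LHS≡closed : ∀ n g → LHS n g ≡ + AG.closed n (n + 2 ∸ 2 * g)
  LHS≡closed n g = byCases (2 * g ℕP.≤? n + 2)
    where
      byCases : Dec (2 * g ≤ n + 2) → LHS n g ≡ + AG.closed n (n + 2 ∸ 2 * g)
      byCases (yes le) = trans (LHS-F n g le) (AG.F≡closed n (n + 2 ∸ 2 * g))
      byCases (no nle) = trans (LHS-0 n g (ℕP.≰⇒> nle))
                               (cong (λ d → + AG.closed n d) (sym (ℕP.m≤n⇒m∸n≡0 (ℕP.<⇒≤ (ℕP.≰⇒> nle)))))

  closed-small : ∀ n d → d < 2 → AG.closed n d ≡ 0
  closed-small n zero _ = refl
  closed-small n (suc zero) _ = refl
  closed-small n (suc (suc d)) (s≤s (s≤s ()))

  degree-small : ∀ n g → n < 2 * g → n + 2 ∸ 2 * g < 2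
  degree-small n g lt = s≤s (begin
      n + 2 ∸ 2 * g   ≤⟨ ℕP.∸-monoʳ-≤ (n + 2) lt ⟩
      n + 2 ∸ suc n   ≡⟨ cong (_∸ suc n) (ℕP.+-suc n 1) ⟩
      suc n + 1 ∸ suc n ≡⟨ ℕP.m+n∸m≡n (suc n) 1 ⟩
      1               ∎)
    where open ℕP.≤-Reasoning

  closed≡O : ∀ n g → AG.closed n (n + 2 ∸ 2 * g) ≡ 2 ^ (n ∸ 2 * g) * O (suc n) g
  closed≡O n g = byCases (2 * g ℕP.≤? n)
    where
      byCases : Dec (2 * g ≤ n) → AG.closed n (n + 2 ∸ 2 * g) ≡ 2 ^ (n ∸ 2 * g) * O (suc n) g
      byCases (yes le) = trans (cong (AG.closed n) degree) (cong (2 ^ (n ∸ 2 * g) *_) (sym (O-A n g le)))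
        where
          degree : n + 2 ∸ 2 * g ≡ suc (suc (n ∸ 2 * g))
          degree = trans (ℕP.+-∸-comm 2 le) (ℕP.+-comm (n ∸ 2 * g) 2)
      byCases (no nle) = trans (closed-small n _ (degree-small n g (ℕP.≰⇒> nle)))
                               (sym (trans (cong (2 ^ (n ∸ 2 * g) *_) (O-0 n g (ℕP.≰⇒> nle))) (ℕP.*-zeroʳ (2 ^ (n ∸ 2 * g)))))

open import Defs
open import Data.Nat using (ℕ; _+_; _*_; _∸_; _^_)
open import Data.Nat.Properties using (+-comm)
open import Data.Integer using (ℤ; +_)
open import Relation.Binary.PropositionalEquality using (_≡_; cong; module ≡-Reasoning)
open Assembly using (module AG; LHS≡closed; closed≡O)

theorem2p10 : ∀ (n g : ℕ) → LHS n g ≡ + (2 ^ (n ∸ 2 * g) * O (n + 1) g)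
theorem2p10 n g = begin
    LHS n g                              ≡⟨ LHS≡closed n g ⟩
    + AG.closed n (n + 2 ∸ 2 * g)        ≡⟨ cong +_ (closed≡O n g) ⟩
    + (2 ^ (n ∸ 2 * g) * O (1 + n) g)    ≡⟨ cong (λ m → + (2 ^ (n ∸ 2 * g) * O m g)) (+-comm 1 n) ⟩
    + (2 ^ (n ∸ 2 * g) * O (n + 1) g)    ∎
  where open ≡-Reasoning
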